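{- Let $L$ be an $\mathbb{A}$-field and $\phi$ a rank $r$ Drinfeld module over $L$ with $\phi_T=T+\sum_{i=1}^rA_i\tau^i$. For $m\in\mathbb{N}$ define $c(n;m)\in L$ by $\phi_{T^m}=\sum_{n=0}^{rm}c(n;m)\tau^n$, and $c(n;m)=0$ for $n<0$ or $n>rm$. Then for all $m,n\ge0$, \[c(n;m)=\sum_{\mathbf{S}\in P_r(n)}\mathbf{A}^{\mathbf{S}}\cdot h^{(\bigcup\mathbf{S}\,\cup\,\{n\})}_{m-|\mathbf{S}|}.\]
   Context: $q$ is a prime power, $\mathbb{A}=\mathbb{F}_q[T]$. An $\mathbb{A}$-field is a field $L$ with a nonzero ring homomorphism $\iota:\mathbb{A}\to L$; we write $a$ for $\iota(a)$. $\tau$ is the $q$-Frobenius and $L\{\tau\}$ the twisted polynomial ring with $\tau\ell=\ell^q\tau$. A rank $r$ Drinfeld module over $L$ is an $\mathbb{F}_q$-linear ring homomorphism $\phi:\mathbb{A}\to L\{\tau\}$ with $\phi_T=T+\sum_{i=1}^rA_i\tau^i$, $A_r\ne0$. For finite $S\subset\mathbb{N}$, $w(S)=\sum_{i\in S}q^i$. For $n\in\mathbb{Z}$ and finite $S\subset\mathbb{N}$, $I_n(S)$ is the set of families $(k_i)_{i\in S}$ with $k_i\in\mathbb{N}$ and $\sum_{i\in S}k_i=n$ (so $I_n(S)=\emptyset$ for $n<0$, $I_0(\emptyset)=\{\emptyset\}$, $I_n(\emptyset)=\emptyset$ for $n\ne0$), and $h^S_n:=\sum_{(k_i)\in I_n(S)}T^{\sum_{i\in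 S}k_iq^i}$. Shadowed partitions: for $n>0$, $P_r(n)$ is the set of $r$-tuples $\mathbf{S}=(S_1,\dots,S_r)$ of subsets of $\{0,\dots,n-1\}$ such that the sets $S_i+j:=\{s+j:s\in S_i\}$ ($1\le i\le r$, $0\le j\le i-1$) form a partition of $\{0,\dots,n-1\}$; $P_r(0)$ consists only of the tuple of empty sets. For $\mathbf{S}\in P_r(n)$: $|\mathbf{S}|=\sum_i|S_i|$, $\bigcup\mathbf{S}=\bigcup_iS_i$, $\mathbf{A}^{\mathbf{S}}=\prod_iA_i^{w(S_i)}$. -}

module Defs where

open import Level using (Level; _⊔_; 0ℓ) renaming (suc to lsuc)
open import Algebra.Bundles using (CommutativeRing)
open import Algebra.Morphism.Structures using (module RingMorphisms)
open import Data.Nat as ℕ using (ℕ; zero; suc; _∸_; _≤_; _<_; _<ᵇ_; _≤ᵇ_; _≡ᵇ_)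
open import Data.Nat.Primality using (Prime)
open import Data.Bool using (Bool; true; false; if_then_else_; _∧_; _∨_)
open import Data.Fin using (Fin; toℕ; fromℕ<)
open import Data.Fin.Subset using (Subset; ∣_∣)
open import Data.Vec using (Vec; []; _∷_; lookup)
open import Data.List using (List; []; _∷_; map; foldr; concatMap; upTo; filter; length; zipWith; allFin; _++_; applyUpTo)
import Data.List as List
import Data.Bool.ListAction as BL
open import Data.Product using (Σ; ∃; _×_; _,_)
open import Relation.Nullary using (¬_)
open import Relation.Binary.PropositionalEquality using (_≡_)

record Field (c ℓ : Level) : Set (lsuc (c ⊔ ℓ)) where
  field
    commutativeRing : CommutativeRing c ℓ
  open CommutativeRing commutativeRing public
  field
    1≉0 : ¬ (1# ≈ 0#)
    inverse : ∀ x → ¬ (x ≈ 0#) → ∃ λ y → x * y ≈ 1#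

record HasCardinality {c ℓ} (F : Field c ℓ) (q : ℕ) : Set (c ⊔ ℓ) where
  open Field F
  field
    enum       : Fin q → Carrier
    injective  : ∀ i j → enum i ≈ enum j → i ≡ j
    surjective : ∀ x → ∃ λ i → enum i ≈ x

IsPrimePower : ℕ → Set
IsPrimePower q = Σ ℕ λ p → Σ ℕ λ k → Prime p × 1 ≤ k × q ≡ p ℕ.^ k

-- 𝔸-fields, 𝔸 = 𝔽_q[T].  A ring homomorphism ι : 𝔽_q[T] → L is given
-- (universal property of the polynomial ring) by a ring homomorphism
-- ι₀ : 𝔽_q → L together with the image T := ι(T) ∈ L.

record 𝔸Field (q : ℕ) (c ℓ : Level) : Set (lsuc (c ⊔ ℓ)) where
  field
    L   : Field c ℓ
    𝔽q  : Field 0ℓ 0ℓ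
    card : HasCardinality 𝔽q q
    ι₀  : Field.Carrier 𝔽q → Field.Carrier L
    ι₀-hom : RingMorphisms.IsRingHomomorphism (Field.rawRing 𝔽q) (Field.rawRing L) ι₀
    T   : Field.Carrier L

module _ {c ℓ : Level} (F : Field c ℓ) where
  open Field F

  pow : Carrier → ℕ → Carrier
  pow x zero    = 1#
  pow x (suc n) = x * pow x n

  sumL : List Carrier → Carrier
  sumL = foldr _+_ 0#

  prodL : List Carrier → Carrier
  prodL = foldr _*_ 1#

sumℕ : List ℕ → ℕ
sumℕ = foldr ℕ._+_ 0

-- Since φ is an 𝔽_q-linear ring
-- homomorphism out of 𝔽_q[T], it is determined by
-- φ_T = T + Σ_{i=1}^r A_i τ^i ; the data is (A_i)_{1≤i≤r}, A_r ≠ 0.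
-- (Values A i for i = 0 or i > r are irrelevant and never used.)

record DrinfeldModule {q c ℓ} (K : 𝔸Field q c ℓ) (r : ℕ) : Set (c ⊔ ℓ) where
  open 𝔸Field K
  open Field L
  field
    A    : ℕ → Carrier
    Ar≉0 : ¬ (A r ≈ 0#)

-- The twisted polynomial ring L{τ}: an element Σ f_n τ^n is represented
-- by its coefficient function ℕ → L; multiplication uses τ ℓ = ℓ^q τ,
-- i.e. (f g)_n = Σ_{i=0}^n f_i (g_{n-i})^{q^i}.

module TwistedPolynomials {c ℓ : Level} (L : Field c ℓ) (q : ℕ) where
  open Field L

  TwPoly : Set c
  TwPoly = ℕ → Carrier

  one : TwPoly
  one zero    = 1#
  one (suc _) = 0#

  _·_ : TwPoly → TwPoly → TwPoly
  (f · g) n = sumL L (map (λ i → f i * pow L (g (n ∸ i)) (q ℕ.^ i)) (upTo (suc n)))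

  _^τ_ : TwPoly → ℕ → TwPoly
  f ^τ zero  = one
  f ^τ suc m = f · (f ^τ m)

module _ {q c ℓ} {K : 𝔸Field q c ℓ} {r : ℕ} (φ : DrinfeldModule K r) where
  open 𝔸Field K
  open Field L
  open DrinfeldModule φ
  open TwistedPolynomials L q

  φT : TwPoly
  φT zero    = T
  φT (suc i) = if suc i ≤ᵇ r then A (suc i) else 0#

  φ[T^_] : ℕ → TwPoly
  φ[T^ m ] = φT ^τ m

  coeff : ℕ → ℕ → Carrier
  coeff n m = φ[T^ m ] n

memℕ : ∀ {n} → Subset n → ℕ → Bool
memℕ {n} S k with k ℕ.<? n
... | Relation.Nullary.yes k<n = Data.Vec.lookup S (fromℕ< k<n)
  where import Data.Vec
... | Relation.Nullary.no _ = false

elems : ∀ {n} → Subset n → List ℕ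
elems {n} S = filter (λ k → Data.Bool.T? (memℕ S k)) (upTo n)
  where import Data.Bool

w : ℕ → ∀ {n} → Subset n → ℕ
w q S = sumℕ (map (q ℕ.^_) (elems S))

allSubsets : ∀ n → List (Subset n)
allSubsets zero    = [] ∷ []
allSubsets (suc n) = concatMap (λ S → (false ∷ S) ∷ (true ∷ S) ∷ []) (allSubsets n)

-- all r-tuples of subsets of {0,…,n-1};  the tuple (S_1,…,S_r) is the
-- vector whose entry at position i-1 is S_i
allTuples : ∀ r n → List (Vec (Subset n) r)
allTuples zero    n = [] ∷ []
allTuples (suc r) n = concatMap (λ S → map (S ∷_) (allTuples r n)) (allSubsets n)

module _ {r n : ℕ} (𝐒 : Vec (Subset n) r) where
  S[_] : Fin r → Subset n
  S[ i' ] = lookup 𝐒 i'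

  -- number of pairs (i,j), 1≤i≤r, 0≤j≤i-1, with k ∈ S_i + j
  shadowCount : ℕ → ℕ
  shadowCount k = sumℕ (map (λ i' → sumℕ (map (λ j → if (j ≤ᵇ k) ∧ memℕ S[ i' ] (k ∸ j) then 1 else 0)
                                              (upTo (suc (toℕ i')))))
                            (allFin r))

  -- the family (S_i + j) is a partition of {0,…,n-1}:
  --  * every block lies in {0,…,n-1}: s ∈ S_i ⇒ s + (i-1) < n
  --  * every k < n lies in exactly one block
  isShadowedᵇ : Bool
  isShadowedᵇ =
    BL.all (λ i' → BL.all (λ s → s ℕ.+ toℕ i' <ᵇ n) (elems S[ i' ])) (allFin r)
    ∧ BL.all (λ k → shadowCount k ≡ᵇ 1) (upTo n)

  size : ℕ
  size = sumℕ (map (λ i' → ∣ S[ i' ] ∣) (allFin r))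

  unionWithN : List ℕ
  unionWithN = filter (λ k → Data.Bool.T? (BL.any (λ i' → memℕ S[ i' ] k) (allFin r))) (upTo n) ++ (n ∷ [])
    where import Data.Bool

P : ∀ r n → List (Vec (Subset n) r)
P r n = filter (λ 𝐒 → Data.Bool.T? (isShadowedᵇ 𝐒)) (allTuples r n)
  where import Data.Bool

-- I_k(S): families (k_s)_{s∈S} of naturals with Σ k_s = k, listed as
-- lists of the same length as S (k_s at the position of s)
I : List ℕ → ℕ → List (List ℕ)
I []       zero    = [] ∷ []
I []       (suc _) = []
I (_ ∷ S)  k       = concatMap (λ j → map (j ∷_) (I S (k ∸ j))) (upTo (suc k))

module _ {q c ℓ} (K : 𝔸Field q c ℓ) where
  open 𝔸Field K
  open Field L

  h : List ℕ → ℕ → Carrier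
  h S k = sumL L (map (λ ks → pow L T (sumℕ (zipWith (λ kᵢ i → kᵢ ℕ.* q ℕ.^ i) ks S))) (I S k))

  -- h^S_k for integer index k = m - s: zero when m - s < 0
  h[_-_] : List ℕ → ℕ → ℕ → Carrier
  h[ S - m ] s = if s ≤ᵇ m then h S (m ∸ s) else 0#

module _ {q c ℓ} {K : 𝔸Field q c ℓ} {r : ℕ} (φ : DrinfeldModule K r) where
  open 𝔸Field K
  open Field L
  open DrinfeldModule φ

  A^ : ∀ {n} → Vec (Subset n) r → Carrier
  A^ 𝐒 = prodL L (map (λ i' → pow L (A (suc (toℕ i'))) (w q S[ 𝐒 ][ i' ])) (allFin r))
    where S[_][_] = S[_]

  rhs : ℕ → ℕ → Carrier
  rhs n m = sumL L (map (λ 𝐒 → A^ 𝐒 * h[_-_] K (unionWithN 𝐒) m (size 𝐒)) (P r n))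

module Submission where

-- Since φ_{T^{m+1}} = φ_T φ_{T^m} and τ^i ℓ = ℓ^{q^i} τ^i,
--   c(n;m+1) = T c(n;m) + Σ_{1 ≤ i ≤ min(n,r)} A_i c(n-i;m)^{q^i},
-- and the right-hand side obeys the same recursion: for n > 0 the point 0 lies
-- in exactly one block S_i + 0, so P_r(n) is the disjoint union over i of the
-- images of P_r(n-i) under the insertion that puts 0 into S_i and shifts all
-- sets by i.  Insertion raises |𝐒| by one, turns 𝐀^𝐒 into A_i (𝐀^𝐒′)^{q^i} and
-- ⋃𝐒 ∪ {n} into {0} ∪ (i + (⋃𝐒′ ∪ {n-i})); then h^{{0}∪V}_{k+1} =
-- T h^{{0}∪V}_k + h^V_{k+1} and the additivity of x ↦ x^{q^i} (L contains 𝔽_q,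
-- q = p^k, so has characteristic p) yield the recursion.

open import Defs
open import Level using (Level)
open import Algebra.Bundles using (CommutativeRing)
open import Algebra.Morphism.Structures using (module RingMorphisms)
open import Data.Bool using (Bool; true; false; if_then_else_; _∧_) renaming (T to IsTrue)
open import Data.Bool.Properties using (T-≡; T-∧)
import Data.Bool.ListAction as BL
open import Data.Empty using (⊥; ⊥-elim)
open import Data.Fin as Fin using (Fin; toℕ; fromℕ<)
open import Data.Fin.Subset using (Subset; ∣_∣)
open import Data.List as List
  using (List; []; _∷_; [_]; map; concatMap; _++_; upTo; applyUpTo; allFin; filter; filterᵇ; length; zipWith)
import Data.List.Properties as ListP
open import Data.List.Membership.Propositional using (_∈_; find)
open import Data.List.Membership.Propositional.Properties
  using (∈-allFin; ∈-map⁺; ∈-map⁻; ∈-upTo⁺; ∈-upTo⁻; ∈-filter⁺; ∈-filter⁻; ∈-concatMap⁺; ∈-concatMap⁻)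
open import Data.List.Membership.Propositional.Properties.WithK using (unique∧set⇒bag)
open import Data.List.Relation.Binary.BagAndSetEquality using (∼bag⇒↭)
open import Data.List.Relation.Binary.Permutation.Propositional using (_↭_; ↭⇒↭ₛ′)
import Data.List.Relation.Binary.Permutation.Propositional.Properties as Perm
open import Data.List.Relation.Binary.Permutation.Setoid.Properties using (foldr-commMonoid)
open import Data.List.Relation.Unary.All as All using (All; []; _∷_)
open import Data.List.Relation.Unary.All.Properties using (All¬⇒¬Any; all⁺; all⁻)
open import Data.List.Relation.Unary.Any as Any using (here; there)
open import Data.List.Relation.Unary.AllPairs using ([]; _∷_)
open import Data.List.Relation.Unary.Unique.Propositional using (Unique)
import Data.List.Relation.Unary.Unique.Propositional.Properties as Unique
open import Data.List.Relation.Unary.Any.Properties using (any⁺)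
open import Data.Nat as ℕ using (ℕ; zero; suc; _∸_; _≤_; _<_; _≤ᵇ_; _⊓_; z≤n; s≤s)
import Data.Nat.Properties as ℕP
open import Data.Nat.ListAction.Properties using (sum-++)
open import Data.Nat.Combinatorics using (_C_; nC1≡n; nCn≡1; nCk+nC[k+1]≡[n+1]C[k+1]; k>n⇒nCk≡0)
open import Data.Nat.Divisibility using (_∣_; divides; ∣⇒≤)
open import Data.Nat.Primality using (Prime; euclidsLemma; prime⇒nonTrivial; prime⇒nonZero)
open import Data.Product using (Σ-syntax; _×_; _,_; proj₁; proj₂)
open import Data.Sum using (_⊎_; inj₁; inj₂)
open import Data.Vec as Vec using (Vec; []; _∷_; lookup; tabulate)
import Data.Vec.Properties as VecP
open import Function.Bundles using (mk⇔; Equivalence)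
open import Relation.Nullary using (¬_; Dec; yes; no)
open import Relation.Nullary.Decidable using (does; T?; dec-true; dec-false)
open import Relation.Binary.PropositionalEquality as ≡
  using (_≡_; _≢_; refl; cong; cong₂; subst)

module ListSums {c ℓ : Level} (F : Field c ℓ) where
  open Field F renaming (refl to ≈-refl; sym to ≈-sym; trans to ≈-trans)
  open import Relation.Binary.Reasoning.Setoid setoid

  Σ : List Carrier → Carrier
  Σ = sumL F

  Π : List Carrier → Carrier
  Π = prodL F

  Σ-cong : ∀ {a} {A : Set a} {f g : A → Carrier} xs → (∀ x → f x ≈ g x) → Σ (map f xs) ≈ Σ (map g xs)
  Σ-cong []       f≈g = ≈-refl
  Σ-cong (x ∷ xs) f≈g = +-cong (f≈g x) (Σ-cong xs f≈g)

  Σ-map-∘ : ∀ {a b} {A : Set a} {B : Set b} (g : B → Carrier) (f : A → B) xs →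
            Σ (map g (map f xs)) ≡ Σ (map (λ x → g (f x)) xs)
  Σ-map-∘ g f xs = cong Σ (≡.sym (ListP.map-∘ xs))

  Σ-++ : ∀ {a} {A : Set a} (g : A → Carrier) xs ys → Σ (map g (xs ++ ys)) ≈ Σ (map g xs) + Σ (map g ys)
  Σ-++ g []       ys = ≈-sym (+-identityˡ _)
  Σ-++ g (x ∷ xs) ys = ≈-trans (+-congˡ (Σ-++ g xs ys)) (≈-sym (+-assoc _ _ _))

  Σ-+ : ∀ {a} {A : Set a} (f g : A → Carrier) xs →
        Σ (map (λ x → f x + g x) xs) ≈ Σ (map f xs) + Σ (map g xs)
  Σ-+ f g []       = ≈-sym (+-identityˡ _)
  Σ-+ f g (x ∷ xs) = begin
    (f x + g x) + Σ (map (λ x → f x + g x) xs) ≈⟨ +-congˡ (Σ-+ f g xs) ⟩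
    (f x + g x) + (Σ (map f xs) + Σ (map g xs)) ≈⟨ +-assoc _ _ _ ⟩
    f x + (g x + (Σ (map f xs) + Σ (map g xs))) ≈⟨ +-congˡ (x∙yz≈y∙xz _ _ _) ⟩
    f x + (Σ (map f xs) + (g x + Σ (map g xs))) ≈⟨ ≈-sym (+-assoc _ _ _) ⟩
    (f x + Σ (map f xs)) + (g x + Σ (map g xs)) ∎
    where open import Algebra.Properties.CommutativeSemigroup +-commutativeSemigroup using (x∙yz≈y∙xz)

  Σ-*ˡ : ∀ {a} {A : Set a} (k : Carrier) (f : A → Carrier) xs → Σ (map (λ x → k * f x) xs) ≈ k * Σ (map f xs)
  Σ-*ˡ k f []       = ≈-sym (zeroʳ k)
  Σ-*ˡ k f (x ∷ xs) = ≈-trans (+-congˡ (Σ-*ˡ k f xs)) (≈-sym (distribˡ k _ _))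

  Σ-zero : ∀ {a} {A : Set a} (f : A → Carrier) xs → (∀ x → f x ≈ 0#) → Σ (map f xs) ≈ 0#
  Σ-zero f []       f≈0 = ≈-refl
  Σ-zero f (x ∷ xs) f≈0 = ≈-trans (+-cong (f≈0 x) (Σ-zero f xs f≈0)) (+-identityˡ 0#)

  Σ-concatMap : ∀ {a b} {A : Set a} {B : Set b} (g : B → Carrier) (f : A → List B) xs →
                Σ (map g (concatMap f xs)) ≈ Σ (map (λ x → Σ (map g (f x))) xs)
  Σ-concatMap g f []       = ≈-refl
  Σ-concatMap g f (x ∷ xs) = ≈-trans (Σ-++ g (f x) (concatMap f xs)) (+-congˡ (Σ-concatMap g f xs))

  Σ-↭ : ∀ {xs ys} → xs ↭ ys → Σ xs ≈ Σ ys
  Σ-↭ p = foldr-commMonoid setoid +-isCommutativeMonoid (↭⇒↭ₛ′ isEquivalence p)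

  Σ-sameMembers : ∀ {a} {A : Set a} (g : A → Carrier) {xs ys : List A} → Unique xs → Unique ys →
                  (∀ {z} → z ∈ xs → z ∈ ys) → (∀ {z} → z ∈ ys → z ∈ xs) → Σ (map g xs) ≈ Σ (map g ys)
  Σ-sameMembers g ux uy xs⊆ys ys⊆xs =
    Σ-↭ (Perm.map⁺ g (∼bag⇒↭ (unique∧set⇒bag ux uy (mk⇔ xs⊆ys ys⊆xs))))

  Π-cong : ∀ {a} {A : Set a} {f g : A → Carrier} xs → (∀ x → f x ≈ g x) → Π (map f xs) ≈ Π (map g xs)
  Π-cong []       f≈g = ≈-refl
  Π-cong (x ∷ xs) f≈g = *-cong (f≈g x) (Π-cong xs f≈g)

  Π-* : ∀ {a} {A : Set a} (f g : A → Carrier) xs → Π (map (λ x → f x * g x) xs) ≈ Π (map f xs) * Π (map g xs)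
  Π-* f g []       = ≈-sym (*-identityˡ 1#)
  Π-* f g (x ∷ xs) = begin
    (f x * g x) * Π (map (λ x → f x * g x) xs) ≈⟨ *-congˡ (Π-* f g xs) ⟩
    (f x * g x) * (Π (map f xs) * Π (map g xs)) ≈⟨ *-assoc _ _ _ ⟩
    f x * (g x * (Π (map f xs) * Π (map g xs))) ≈⟨ *-congˡ (x∙yz≈y∙xz _ _ _) ⟩
    f x * (Π (map f xs) * (g x * Π (map g xs))) ≈⟨ ≈-sym (*-assoc _ _ _) ⟩
    (f x * Π (map f xs)) * (g x * Π (map g xs)) ∎
    where open import Algebra.Properties.CommutativeSemigroup *-commutativeSemigroup using (x∙yz≈y∙xz)

  Π-ones : ∀ {a} {A : Set a} (f : A → Carrier) xs → (∀ {x} → x ∈ xs → f x ≈ 1#) → Π (map f xs) ≈ 1#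
  Π-ones f []       _    = ≈-refl
  Π-ones f (x ∷ xs) ones = ≈-trans (*-cong (ones (here refl)) (Π-ones f xs (λ x∈ → ones (there x∈)))) (*-identityˡ 1#)

  Π-single : ∀ {a} {A : Set a} (f : A → Carrier) {xs x} → Unique xs → x ∈ xs →
             (∀ y → y ≢ x → f y ≈ 1#) → Π (map f xs) ≈ f x
  Π-single f {z ∷ xs} (z∉xs ∷ u) (here refl) f≈1 =
    ≈-trans (*-congˡ (Π-ones f xs λ y∈ → f≈1 _ (λ { refl → All¬⇒¬Any z∉xs y∈ }))) (*-identityʳ _)
  Π-single f {z ∷ xs} (z∉xs ∷ u) (there x∈) f≈1 =
    ≈-trans (*-cong (f≈1 z (λ { refl → All¬⇒¬Any z∉xs x∈ })) (Π-single f u x∈ f≈1)) (*-identityˡ _)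

module Powers {c ℓ : Level} (F : Field c ℓ) where
  open Field F renaming (refl to ≈-refl; sym to ≈-sym; trans to ≈-trans)
  open import Algebra.Properties.CommutativeSemiring.Exp commutativeSemiring
    using (_^_; ^-distrib-*; ^-assocʳ; ^-congˡ; ^-homo-*)

  pow≡^ : ∀ x n → pow F x n ≡ x ^ n
  pow≡^ x zero    = refl
  pow≡^ x (suc n) = cong (x *_) (pow≡^ x n)

  pow-congˡ : ∀ {x y} n → x ≈ y → pow F x n ≈ pow F y n
  pow-congˡ {x} {y} n x≈y rewrite pow≡^ x n | pow≡^ y n = ^-congˡ n x≈y

  pow-congʳ : ∀ x {m n} → m ≡ n → pow F x m ≈ pow F x n
  pow-congʳ x refl = ≈-refl

  pow-+ : ∀ x m n → pow F x (m ℕ.+ n) ≈ pow F x m * pow F x n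
  pow-+ x m n rewrite pow≡^ x (m ℕ.+ n) | pow≡^ x m | pow≡^ x n = ^-homo-* x m n

  pow-pow : ∀ x m n → pow F (pow F x m) n ≈ pow F x (m ℕ.* n)
  pow-pow x m n rewrite pow≡^ (pow F x m) n | pow≡^ x m | pow≡^ x (m ℕ.* n) = ^-assocʳ x m n

  pow-* : ∀ x y n → pow F (x * y) n ≈ pow F x n * pow F y n
  pow-* x y n rewrite pow≡^ (x * y) n | pow≡^ x n | pow≡^ y n = ^-distrib-* x y n

  pow-1 : ∀ x → pow F x 1 ≈ x
  pow-1 = *-identityʳ

  pow-1# : ∀ n → pow F 1# n ≈ 1#
  pow-1# zero    = ≈-refl
  pow-1# (suc n) = ≈-trans (*-identityˡ _) (pow-1# n)

  pow-0# : ∀ n → 0 < n → pow F 0# n ≈ 0#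
  pow-0# (suc n) _ = zeroˡ _

  pow-Π : ∀ e xs → pow F (prodL F xs) e ≈ prodL F (map (λ x → pow F x e) xs)
  pow-Π e []       = pow-1# e
  pow-Π e (x ∷ xs) = ≈-trans (pow-* x _ e) (*-congˡ (pow-Π e xs))

absorption : ∀ n k → suc k ℕ.* (suc n C suc k) ≡ suc n ℕ.* (n C k)
absorption zero zero = refl
absorption zero (suc k) rewrite k>n⇒nCk≡0 {1} {suc (suc k)} (s≤s (s≤s z≤n)) | ℕP.*-zeroʳ k = refl
absorption (suc n) zero = ≡.trans (ℕP.*-identityˡ _) (≡.trans (nC1≡n (suc (suc n))) (≡.sym (ℕP.*-identityʳ _)))
absorption (suc n) (suc k) = begin
    suc (suc k) * (suc (suc n) C suc (suc k))
      ≡⟨ cong (suc (suc k) *_) (≡.sym (nCk+nC[k+1]≡[n+1]C[k+1] (suc n) (suc k))) ⟩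
    suc (suc k) * (a + b)
      ≡⟨ ℕP.*-distribˡ-+ (suc (suc k)) a b ⟩
    (a + suc k * a) + suc (suc k) * b
      ≡⟨ cong₂ (λ u v → (a + u) + v) (absorption n k) (absorption n (suc k)) ⟩
    (a + suc n * (n C k)) + suc n * (n C suc k)
      ≡⟨ ℕP.+-assoc a _ _ ⟩
    a + (suc n * (n C k) + suc n * (n C suc k))
      ≡⟨ cong (a +_) (≡.sym (ℕP.*-distribˡ-+ (suc n) (n C k) (n C suc k))) ⟩
    a + suc n * (n C k + n C suc k)
      ≡⟨ cong (λ u → a + suc n * u) (nCk+nC[k+1]≡[n+1]C[k+1] n k) ⟩
    a + suc n * a ∎
  where
  open ≡.≡-Reasoning
  open import Data.Nat using (_+_; _*_)
  a = suc n C suc k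
  b = suc n C suc (suc k)

-- A prime p divides the interior binomial coefficients C(p,k), 0 < k < p:
-- k·C(p,k) = p·C(p-1,k-1) and p does not divide k.
prime∣choose : ∀ {p} → Prime p → ∀ k → 0 < k → k < p → p ∣ (p C k)
prime∣choose {suc n} p-prime (suc k) _ k<p
  with euclidsLemma (suc k) (suc n C suc k) p-prime
         (divides (n C k) (≡.trans (absorption n k) (ℕP.*-comm (suc n) (n C k))))
... | inj₁ p∣k  = ⊥-elim (ℕP.<⇒≱ k<p (∣⇒≤ p∣k))
... | inj₂ p∣pCk = p∣pCk

module Frobenius {c ℓ : Level} (R : CommutativeRing c ℓ) {p : ℕ} (p-prime : Prime p) where
  open CommutativeRing R renaming (refl to ≈-refl; sym to ≈-sym; trans to ≈-trans)
  open import Relation.Binary.Reasoning.Setoid setoid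
  open import Algebra.Properties.Semiring.Mult semiring using (×-assocˡ; ×-assoc-*; ×-congʳ) renaming (_×_ to _×ᵣ_)
  open import Algebra.Properties.CommutativeSemiring.Exp commutativeSemiring using (_^_; ^-assocʳ; ^-congˡ)
  open import Algebra.Properties.CommutativeSemiring.Binomial commutativeSemiring
    using (binomialExpansion; binomialTerm) renaming (theorem to binomial-theorem)
  open import Algebra.Properties.Semiring.Sum semiring using (sum; sum-init-last; sum-cong-≋; sum-replicate-zero)
  open import Data.Vec.Functional using (Vector; replicate; init; last; tail)
  open import Data.Fin.Properties using (toℕ-fromℕ; toℕ-inject₁; toℕ<n)

  module _ (char-p : p ×ᵣ 1# ≈ 0#) where

    multiple-of-p≈0 : ∀ d z → (d ℕ.* p) ×ᵣ z ≈ 0#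
    multiple-of-p≈0 d z = begin
      (d ℕ.* p) ×ᵣ z    ≈⟨ ×-assocˡ z d p ⟨
      d ×ᵣ (p ×ᵣ z)     ≈⟨ ×-congʳ d (×-congʳ p (*-identityˡ z)) ⟨
      d ×ᵣ (p ×ᵣ (1# * z)) ≈⟨ ×-congʳ d (×-assoc-* p 1# z) ⟨
      d ×ᵣ ((p ×ᵣ 1#) * z) ≈⟨ ×-congʳ d (≈-trans (*-congʳ char-p) (zeroˡ z)) ⟩
      d ×ᵣ 0#           ≈⟨ d×0 d ⟩
      0#                ∎
      where
      d×0 : ∀ d → d ×ᵣ 0# ≈ 0#
      d×0 zero    = ≈-refl
      d×0 (suc d) = ≈-trans (+-identityˡ _) (d×0 d)

    -- the binomial expansion of (x + y)^p has only its two extreme terms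
    frobenius : ∀ x y → (x + y) ^ p ≈ x ^ p + y ^ p
    frobenius x y = expand p refl (prime⇒nonTrivial p-prime)
      where
      expand : ∀ p′ → p′ ≡ p → ℕ.NonTrivial p′ → (x + y) ^ p ≈ x ^ p + y ^ p
      expand (suc (suc p″)) refl _ = begin
        (x + y) ^ p                                         ≈⟨ binomial-theorem p x y ⟩
        binomialExpansion x y p                             ≈⟨ +-congˡ (sum-init-last (tail t)) ⟩
        t Fin.zero + (sum (init (tail t)) + last (tail t))  ≈⟨ +-cong first (+-cong interior final) ⟩
        y ^ p + (0# + x ^ p)                                ≈⟨ +-comm _ _ ⟩
        (0# + x ^ p) + y ^ p                                ≈⟨ +-congʳ (+-identityˡ _) ⟩
        x ^ p + y ^ p                                       ∎
        where
        t : Vector Carrier (suc p)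
        t = binomialTerm x y p
        first : t Fin.zero ≈ y ^ p
        first = ≈-trans (+-identityʳ _) (*-identityˡ _)
        final : last (tail t) ≈ x ^ p
        final = begin
          last (tail t)                     ≡⟨ cong (λ k → (p C k) ×ᵣ (x ^ k * y ^ (p ∸ k))) (cong suc (toℕ-fromℕ (suc p″))) ⟩
          (p C p) ×ᵣ (x ^ p * y ^ (p ∸ p))  ≡⟨ cong₂ (λ a b → a ×ᵣ (x ^ p * y ^ b)) (nCn≡1 p) (ℕP.n∸n≡0 p) ⟩
          1 ×ᵣ (x ^ p * 1#)                 ≈⟨ +-identityʳ _ ⟩
          x ^ p * 1#                        ≈⟨ *-identityʳ _ ⟩
          x ^ p                             ∎
        interior-term : ∀ k z → 0 < k → k < p → (p C k) ×ᵣ z ≈ 0#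
        interior-term k z 0<k k<p with prime∣choose p-prime k 0<k k<p
        ... | divides d pCk≡d*p = ≈-trans (reflexive (cong (_×ᵣ z) pCk≡d*p)) (multiple-of-p≈0 d z)
        interior : sum (init (tail t)) ≈ 0#
        interior = ≈-trans (sum-cong-≋ {suc p″} {init (tail t)} {replicate (suc p″) 0#} λ i →
                     interior-term (suc (toℕ (Fin.inject₁ i))) _ (s≤s z≤n)
                       (s≤s (subst (ℕ._< suc p″) (≡.sym (toℕ-inject₁ i)) (toℕ<n i))))
                     (sum-replicate-zero (suc p″))

    frobenius-iterated : ∀ j x y → (x + y) ^ (p ℕ.^ j) ≈ x ^ (p ℕ.^ j) + y ^ (p ℕ.^ j)
    frobenius-iterated zero    x y = ≈-trans (*-identityʳ _) (+-cong (≈-sym (*-identityʳ _)) (≈-sym (*-identityʳ _)))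
    frobenius-iterated (suc j) x y = begin
      (x + y) ^ (p ℕ.* p ℕ.^ j)                  ≈⟨ ^-assocʳ _ p _ ⟨
      ((x + y) ^ p) ^ (p ℕ.^ j)                  ≈⟨ ^-congˡ (p ℕ.^ j) (frobenius x y) ⟩
      (x ^ p + y ^ p) ^ (p ℕ.^ j)                ≈⟨ frobenius-iterated j _ _ ⟩
      (x ^ p) ^ (p ℕ.^ j) + (y ^ p) ^ (p ℕ.^ j)  ≈⟨ +-cong (^-assocʳ _ p _) (^-assocʳ _ p _) ⟩
      x ^ (p ℕ.* p ℕ.^ j) + y ^ (p ℕ.* p ℕ.^ j)  ∎

module FiniteFieldCharacteristic {c ℓ : Level} (F : Field c ℓ) {q : ℕ} (card : HasCardinality F q) where
  open Field F renaming (refl to ≈-refl; sym to ≈-sym; trans to ≈-trans)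
  open HasCardinality card
  open import Relation.Binary.Reasoning.Setoid setoid
  open import Algebra.Properties.Semiring.Mult semiring using (×1-homo-*) renaming (_×_ to _×ᵣ_)
  open import Algebra.Properties.CommutativeSemiring.Exp commutativeSemiring using (_^_; ^-distrib-*; ^-congˡ)
  open ListSums F using (Σ; Σ-cong; Σ-map-∘; Σ-+; Σ-sameMembers)

  index : Carrier → Fin q
  index x = proj₁ (surjective x)

  enum-index : ∀ x → enum (index x) ≈ x
  enum-index x = proj₂ (surjective x)

  _≈?_ : ∀ x y → Dec (x ≈ y)
  x ≈? y with index x Fin.≟ index y
  ... | yes i≡j = yes (≈-trans (≈-sym (enum-index x)) (≈-trans (reflexive (cong enum i≡j)) (enum-index y)))
  ... | no  i≢j = no λ x≈y → i≢j (injective _ _ (≈-trans (enum-index x) (≈-trans x≈y (≈-sym (enum-index y)))))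

  shift unshift : Fin q → Fin q
  shift i   = index (1# + enum i)
  unshift j = index (enum j - 1#)

  shift-injective : ∀ {i j} → shift i ≡ shift j → i ≡ j
  shift-injective {i} {j} eq = injective i j (begin
    enum i                ≈⟨ cancel (enum i) ⟨
    - 1# + (1# + enum i)  ≈⟨ +-congˡ (enum-index _) ⟨
    - 1# + enum (shift i) ≡⟨ cong (λ k → - 1# + enum k) eq ⟩
    - 1# + enum (shift j) ≈⟨ +-congˡ (enum-index _) ⟩
    - 1# + (1# + enum j)  ≈⟨ cancel (enum j) ⟩
    enum j                ∎)
    where
    cancel : ∀ x → - 1# + (1# + x) ≈ x
    cancel x = ≈-trans (≈-sym (+-assoc _ _ _)) (≈-trans (+-congʳ (-‿inverseˡ 1#)) (+-identityˡ x))

  shift-unshift : ∀ j → shift (unshift j) ≡ j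
  shift-unshift j = injective _ _ (begin
    enum (shift (unshift j)) ≈⟨ enum-index _ ⟩
    1# + enum (unshift j)    ≈⟨ +-congˡ (enum-index _) ⟩
    1# + (enum j - 1#)       ≈⟨ +-comm _ _ ⟩
    (enum j - 1#) + 1#       ≈⟨ +-assoc _ _ _ ⟩
    enum j + (- 1# + 1#)     ≈⟨ +-congˡ (-‿inverseˡ 1#) ⟩
    enum j + 0#              ≈⟨ +-identityʳ _ ⟩
    enum j                   ∎)

  -- Σ_x x = Σ_x (1 + x) = q·1 + Σ_x x, hence q·1 = 0
  q·1≈0 : q ×ᵣ 1# ≈ 0#
  q·1≈0 = begin
    q ×ᵣ 1#                 ≈⟨ +-identityʳ _ ⟨
    q ×ᵣ 1# + 0#            ≈⟨ +-congˡ (-‿inverseʳ S) ⟨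
    q ×ᵣ 1# + (S - S)       ≈⟨ +-assoc _ _ _ ⟨
    (q ×ᵣ 1# + S) - S       ≈⟨ +-congʳ S≈q·1+S ⟨
    S - S                   ≈⟨ -‿inverseʳ S ⟩
    0#                      ∎
    where
    S = Σ (map enum (allFin q))
    ones : ∀ {a} {A : Set a} (xs : List A) → Σ (map (λ _ → 1#) xs) ≈ length xs ×ᵣ 1#
    ones []       = ≈-refl
    ones (x ∷ xs) = +-congˡ (ones xs)
    S≈q·1+S : S ≈ q ×ᵣ 1# + S
    S≈q·1+S = begin
      S                                           ≈⟨ Σ-sameMembers enum (Unique.allFin⁺ q) (Unique.map⁺ shift-injective (Unique.allFin⁺ q))
                                                       (λ {z} _ → subst (_∈ map shift (allFin q)) (shift-unshift z) (∈-map⁺ shift (∈-allFin (unshift z))))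
                                                       (λ {z} _ → ∈-allFin z) ⟩
      Σ (map enum (map shift (allFin q)))         ≡⟨ Σ-map-∘ enum shift (allFin q) ⟩
      Σ (map (λ i → enum (shift i)) (allFin q))   ≈⟨ Σ-cong (allFin q) (λ i → enum-index _) ⟩
      Σ (map (λ i → 1# + enum i) (allFin q))      ≈⟨ Σ-+ (λ _ → 1#) enum (allFin q) ⟩
      Σ (map (λ _ → 1#) (allFin q)) + S           ≈⟨ +-congʳ (ones (allFin q)) ⟩
      length (allFin q) ×ᵣ 1# + S                 ≡⟨ cong (λ n → n ×ᵣ 1# + S) (ListP.length-tabulate {n = q} (λ i → i)) ⟩
      q ×ᵣ 1# + S                                 ∎

  -- if q = p^k then p·1 = 0: otherwise p·1 would be invertible, and so would
  -- (p·1)^k = q·1 = 0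
  p·1≈0 : ∀ p k → q ≡ p ℕ.^ k → p ×ᵣ 1# ≈ 0#
  p·1≈0 p k q≡p^k with (p ×ᵣ 1#) ≈? 0#
  ... | yes p·1≈0 = p·1≈0
  ... | no  p·1≉0 with inverse (p ×ᵣ 1#) p·1≉0
  ... | y , p·1*y≈1 = ⊥-elim (1≉0 (begin
      1#                             ≈⟨ 1^ k ⟨
      1# ^ k                         ≈⟨ ^-congˡ k p·1*y≈1 ⟨
      ((p ×ᵣ 1#) * y) ^ k            ≈⟨ ^-distrib-* _ _ k ⟩
      (p ×ᵣ 1#) ^ k * y ^ k          ≈⟨ *-congʳ (^-of-multiple k) ⟨
      ((p ℕ.^ k) ×ᵣ 1#) * y ^ k      ≡⟨ cong (λ n → (n ×ᵣ 1#) * y ^ k) (≡.sym q≡p^k) ⟩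
      (q ×ᵣ 1#) * y ^ k              ≈⟨ *-congʳ q·1≈0 ⟩
      0# * y ^ k                     ≈⟨ zeroˡ _ ⟩
      0#                             ∎))
    where
    1^ : ∀ n → 1# ^ n ≈ 1#
    1^ zero    = ≈-refl
    1^ (suc n) = ≈-trans (*-identityˡ _) (1^ n)
    ^-of-multiple : ∀ n → (p ℕ.^ n) ×ᵣ 1# ≈ (p ×ᵣ 1#) ^ n
    ^-of-multiple zero    = +-identityʳ 1#
    ^-of-multiple (suc n) = ≈-trans (×1-homo-* p (p ℕ.^ n)) (*-congˡ (^-of-multiple n))

≤ᵇ-true : ∀ {m n} → m ≤ n → (m ≤ᵇ n) ≡ true
≤ᵇ-true m≤n = Equivalence.to T-≡ (ℕP.≤⇒≤ᵇ m≤n)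

≤ᵇ-sound : ∀ {m n} → (m ≤ᵇ n) ≡ true → m ≤ n
≤ᵇ-sound {m} {n} eq = ℕP.≤ᵇ⇒≤ m n (Equivalence.from T-≡ eq)

≤ᵇ-false : ∀ {m n} → n < m → (m ≤ᵇ n) ≡ false
≤ᵇ-false {m} {n} n<m with m ≤ᵇ n in eq
... | true  = ⊥-elim (ℕP.<⇒≱ n<m (≤ᵇ-sound eq))
... | false = refl

χ : Bool → ℕ
χ b = if b then 1 else 0

χ-positive : ∀ {b} → 0 < χ b → b ≡ true
χ-positive {true} _ = refl

member : ∀ {n} → Subset n → ℕ → Bool
member []      k       = false
member (b ∷ S) zero    = b
member (b ∷ S) (suc k) = member S k

member-out : ∀ {n} (S : Subset n) k → n ≤ k → member S k ≡ false
member-out []      k       _         = refl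
member-out (b ∷ S) (suc k) (s≤s n≤k) = member-out S k n≤k

member-in-range : ∀ {n} (S : Subset n) k → member S k ≡ true → k < n
member-in-range {n} S k k∈S with k ℕ.<? n
... | yes k<n = k<n
... | no  k≮n with ≡.trans (≡.sym k∈S) (member-out S k (ℕP.≮⇒≥ k≮n))
...   | ()

memℕ≡member : ∀ {n} (S : Subset n) k → memℕ S k ≡ member S k
memℕ≡member {n} S k with k ℕ.<? n
... | yes k<n = lookup-fromℕ< S k k<n
  where
  lookup-fromℕ< : ∀ {n} (S : Subset n) k (k<n : k < n) → lookup S (fromℕ< k<n) ≡ member S k
  lookup-fromℕ< (b ∷ S) zero    _         = refl
  lookup-fromℕ< (b ∷ S) (suc k) (s≤s k<n) = lookup-fromℕ< S k k<n
... | no  k≮n = ≡.sym (member-out S k (ℕP.≮⇒≥ k≮n))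

subset-ext : ∀ {n} (S S′ : Subset n) → (∀ k → k < n → member S k ≡ member S′ k) → S ≡ S′
subset-ext []      []        _  = refl
subset-ext (b ∷ S) (b′ ∷ S′) eq = cong₂ _∷_ (eq 0 (s≤s z≤n)) (subset-ext S S′ λ k k< → eq (suc k) (s≤s k<))

tuple-ext : ∀ {a} {A : Set a} {r} (v w : Vec A r) → (∀ i → lookup v i ≡ lookup w i) → v ≡ w
tuple-ext v w eq = ≡.trans (≡.sym (VecP.tabulate∘lookup v)) (≡.trans (VecP.tabulate-cong eq) (VecP.tabulate∘lookup w))

subsetOf : ∀ n → (ℕ → Bool) → Subset n
subsetOf zero    f = []
subsetOf (suc n) f = f 0 ∷ subsetOf n (λ x → f (suc x))

member-subsetOf : ∀ n f k → k < n → member (subsetOf n f) k ≡ f k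
member-subsetOf (suc n) f zero    _         = refl
member-subsetOf (suc n) f (suc k) (s≤s k<n) = member-subsetOf n (λ x → f (suc x)) k k<n

filterᵇ-cong : ∀ {a} {A : Set a} (b b′ : A → Bool) xs → (∀ {x} → x ∈ xs → b x ≡ b′ x) → filterᵇ b xs ≡ filterᵇ b′ xs
filterᵇ-cong b b′ []       eq = refl
filterᵇ-cong b b′ (x ∷ xs) eq with b x | b′ x | eq (here refl)
... | true  | true  | refl = cong (x ∷_) (filterᵇ-cong b b′ xs (λ x∈ → eq (there x∈)))
... | false | false | refl = filterᵇ-cong b b′ xs (λ x∈ → eq (there x∈))

filterᵇ-map : ∀ {a b} {A : Set a} {B : Set b} (p : B → Bool) (f : A → B) xs →
              filterᵇ p (map f xs) ≡ map f (filterᵇ (λ x → p (f x)) xs)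
filterᵇ-map p f []       = refl
filterᵇ-map p f (x ∷ xs) with p (f x)
... | true  = cong (f x ∷_) (filterᵇ-map p f xs)
... | false = filterᵇ-map p f xs

filterᵇ-none : ∀ {a} {A : Set a} (b : A → Bool) xs → (∀ {x} → x ∈ xs → b x ≡ false) → filterᵇ b xs ≡ []
filterᵇ-none b []       _     = refl
filterᵇ-none b (x ∷ xs) rejected with b x | rejected (here refl)
... | false | refl = filterᵇ-none b xs (λ x∈ → rejected (there x∈))

∈-filterᵇ⁺ : ∀ {a} {A : Set a} (b : A → Bool) {xs x} → x ∈ xs → b x ≡ true → x ∈ filterᵇ b xs
∈-filterᵇ⁺ b x∈ bx = ∈-filter⁺ (λ x → T? (b x)) x∈ (Equivalence.from T-≡ bx)

∈-filterᵇ⁻ : ∀ {a} {A : Set a} (b : A → Bool) {xs x} → x ∈ filterᵇ b xs → x ∈ xs × b x ≡ true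
∈-filterᵇ⁻ b {xs} x∈ with ∈-filter⁻ (λ x → T? (b x)) {xs = xs} x∈
... | x∈xs , bx = x∈xs , Equivalence.to T-≡ bx

upTo-+ : ∀ m n → upTo (m ℕ.+ n) ≡ upTo m ++ map (m ℕ.+_) (upTo n)
upTo-+ zero    n = ≡.sym (ListP.map-id (upTo n))
upTo-+ (suc m) n = begin
    upTo (suc (m ℕ.+ n))                                        ≡⟨ upTo-suc (m ℕ.+ n) ⟩
    0 ∷ map suc (upTo (m ℕ.+ n))                                ≡⟨ cong (λ z → 0 ∷ map suc z) (upTo-+ m n) ⟩
    0 ∷ map suc (upTo m ++ map (m ℕ.+_) (upTo n))               ≡⟨ cong (0 ∷_) (ListP.map-++ suc (upTo m) _) ⟩
    0 ∷ (map suc (upTo m) ++ map suc (map (m ℕ.+_) (upTo n)))   ≡⟨ cong (λ z → 0 ∷ (map suc (upTo m) ++ z)) (≡.sym (ListP.map-∘ (upTo n))) ⟩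
    0 ∷ (map suc (upTo m) ++ map (suc m ℕ.+_) (upTo n))         ≡⟨ cong (_++ map (suc m ℕ.+_) (upTo n)) (≡.sym (upTo-suc m)) ⟩
    upTo (suc m) ++ map (suc m ℕ.+_) (upTo n)                   ∎
  where
  open ≡.≡-Reasoning
  upTo-suc : ∀ n → upTo (suc n) ≡ 0 ∷ map suc (upTo n)
  upTo-suc n = cong (0 ∷_) (≡.sym (ListP.map-upTo suc n))

filterᵇ-shifted : ∀ t n (b b′ : ℕ → Bool) →
  (∀ x → 0 < x → x ≤ t → b x ≡ false) → (∀ x → x < n → b (suc t ℕ.+ x) ≡ b′ x) →
  filterᵇ b (upTo (suc t ℕ.+ n)) ≡ (if b 0 then [ 0 ] else []) ++ map (suc t ℕ.+_) (filterᵇ b′ (upTo n))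
filterᵇ-shifted t n b b′ low high = begin
    filterᵇ b (upTo (suc t ℕ.+ n))                                   ≡⟨ cong (filterᵇ b) (upTo-+ (suc t) n) ⟩
    filterᵇ b (upTo (suc t) ++ map (suc t ℕ.+_) (upTo n))            ≡⟨ ListP.filter-++ (λ x → T? (b x)) (upTo (suc t)) _ ⟩
    filterᵇ b (upTo (suc t)) ++ filterᵇ b (map (suc t ℕ.+_) (upTo n)) ≡⟨ cong₂ _++_ initial shifted ⟩
    (if b 0 then [ 0 ] else []) ++ map (suc t ℕ.+_) (filterᵇ b′ (upTo n)) ∎
  where
  open ≡.≡-Reasoning
  positives : filterᵇ b (applyUpTo suc t) ≡ []
  positives = filterᵇ-none b (applyUpTo suc t) λ x∈ → small x∈
    where
    small : ∀ {x} → x ∈ applyUpTo suc t → b x ≡ false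
    small x∈ with ∈-map⁻ suc (subst (_ ∈_) (≡.sym (ListP.map-upTo suc t)) x∈)
    ... | y , y∈ , refl = low (suc y) (s≤s z≤n) (∈-upTo⁻ y∈)
  initial : filterᵇ b (upTo (suc t)) ≡ (if b 0 then [ 0 ] else [])
  initial with b 0
  ... | true  = cong (0 ∷_) positives
  ... | false = positives
  shifted : filterᵇ b (map (suc t ℕ.+_) (upTo n)) ≡ map (suc t ℕ.+_) (filterᵇ b′ (upTo n))
  shifted = ≡.trans (filterᵇ-map b (suc t ℕ.+_) (upTo n))
              (cong (map (suc t ℕ.+_)) (filterᵇ-cong _ _ (upTo n) λ x∈ → high _ (∈-upTo⁻ x∈)))

sumℕ-cong : ∀ {a} {A : Set a} (f g : A → ℕ) xs → (∀ {x} → x ∈ xs → f x ≡ g x) → sumℕ (map f xs) ≡ sumℕ (map g xs)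
sumℕ-cong f g []       eq = refl
sumℕ-cong f g (x ∷ xs) eq = cong₂ ℕ._+_ (eq (here refl)) (sumℕ-cong f g xs (λ x∈ → eq (there x∈)))

sumℕ-zero : ∀ {a} {A : Set a} (f : A → ℕ) xs → (∀ {x} → x ∈ xs → f x ≡ 0) → sumℕ (map f xs) ≡ 0
sumℕ-zero f []       f≡0 = refl
sumℕ-zero f (x ∷ xs) f≡0 = cong₂ ℕ._+_ (f≡0 (here refl)) (sumℕ-zero f xs (λ x∈ → f≡0 (there x∈)))

sumℕ-+ : ∀ {a} {A : Set a} (f g : A → ℕ) xs → sumℕ (map (λ x → f x ℕ.+ g x) xs) ≡ sumℕ (map f xs) ℕ.+ sumℕ (map g xs)
sumℕ-+ f g []       = refl
sumℕ-+ f g (x ∷ xs) rewrite sumℕ-+ f g xs = interchange (f x) (g x) (sumℕ (map f xs)) (sumℕ (map g xs))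
  where open import Algebra.Properties.CommutativeSemigroup ℕP.+-commutativeSemigroup using (interchange)

sumℕ-*ˡ : ∀ {a} {A : Set a} k (f : A → ℕ) xs → sumℕ (map (λ x → k ℕ.* f x) xs) ≡ k ℕ.* sumℕ (map f xs)
sumℕ-*ˡ k f []       = ≡.sym (ℕP.*-zeroʳ k)
sumℕ-*ˡ k f (x ∷ xs) rewrite sumℕ-*ˡ k f xs = ≡.sym (ℕP.*-distribˡ-+ k (f x) _)

term≤sumℕ : ∀ {a} {A : Set a} (f : A → ℕ) {xs x} → x ∈ xs → f x ≤ sumℕ (map f xs)
term≤sumℕ f {y ∷ xs} (here refl) = ℕP.m≤m+n _ _
term≤sumℕ f {y ∷ xs} (there x∈)  = ℕP.≤-trans (term≤sumℕ f x∈) (ℕP.m≤n+m _ (f y))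

two-terms≤sumℕ : ∀ {a} {A : Set a} (f : A → ℕ) {xs x y} → x ∈ xs → y ∈ xs → x ≢ y → f x ℕ.+ f y ≤ sumℕ (map f xs)
two-terms≤sumℕ f (here refl) (here refl) x≢y = ⊥-elim (x≢y refl)
two-terms≤sumℕ f {z ∷ _} (here refl) (there y∈) _ = ℕP.+-monoʳ-≤ (f z) (term≤sumℕ f y∈)
two-terms≤sumℕ f {z ∷ _} {x} (there x∈) (here refl) _ =
  ℕP.≤-trans (ℕP.≤-reflexive (ℕP.+-comm (f x) (f z))) (ℕP.+-monoʳ-≤ (f z) (term≤sumℕ f x∈))
two-terms≤sumℕ f {z ∷ _} (there x∈) (there y∈) x≢y = ℕP.≤-trans (two-terms≤sumℕ f x∈ y∈ x≢y) (ℕP.m≤n+m _ (f z))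

positive-term : ∀ {a} {A : Set a} (f : A → ℕ) xs → 0 < sumℕ (map f xs) → Σ[ x ∈ _ ] (x ∈ xs × 0 < f x)
positive-term f (x ∷ xs) pos with f x in fx
... | suc _ = x , here refl , subst (0 <_) (≡.sym fx) (s≤s z≤n)
... | zero  = let y , y∈ , fy>0 = positive-term f xs pos in y , there y∈ , fy>0

sumℕ-single : ∀ {a} {A : Set a} (f : A → ℕ) {xs x} → Unique xs → x ∈ xs → f x ≡ 1 →
              (∀ {y} → y ∈ xs → y ≢ x → f y ≡ 0) → sumℕ (map f xs) ≡ 1
sumℕ-single f {z ∷ xs} (z∉ ∷ u) (here refl) fx≡1 others =
  cong₂ ℕ._+_ fx≡1 (sumℕ-zero f xs λ y∈ → others (there y∈) λ { refl → All¬⇒¬Any z∉ y∈ })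
sumℕ-single f {z ∷ xs} (z∉ ∷ u) (there x∈) fx≡1 others =
  cong₂ ℕ._+_ (others (here refl) λ { refl → All¬⇒¬Any z∉ x∈ }) (sumℕ-single f u x∈ fx≡1 λ y∈ → others (there y∈))

-- For 𝐒 = (S_1,…,S_r) (row i' of the vector is S_{i'+1}),
-- count 𝐒 k is the number of pairs (i,j), 0 ≤ j < i, with k ∈ S_i + j; 𝐒 is
-- shadowed iff every shifted block lies in {0,…,n-1} (InRange) and every
-- k < n is covered exactly once (Covers).
module ShadowedPartitions {r : ℕ} where

  hit : ∀ {n} → Subset n → ℕ → ℕ → ℕ
  hit S j k = χ ((j ≤ᵇ k) ∧ member S (k ∸ j))

  hit-member : ∀ {n} (S : Subset n) j k → j ≤ k → hit S j k ≡ χ (member S (k ∸ j))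
  hit-member S j k j≤k rewrite ≤ᵇ-true j≤k = refl

  hit-below : ∀ {n} (S : Subset n) j k → k < j → hit S j k ≡ 0
  hit-below S j k k<j rewrite ≤ᵇ-false k<j = refl

  rowCount : ∀ {n} → Vec (Subset n) r → Fin r → ℕ → ℕ
  rowCount 𝐒 i k = sumℕ (map (λ j → hit (lookup 𝐒 i) j k) (upTo (suc (toℕ i))))

  count : ∀ {n} → Vec (Subset n) r → ℕ → ℕ
  count 𝐒 k = sumℕ (map (λ i → rowCount 𝐒 i k) (allFin r))

  InRange : ∀ {n} → Vec (Subset n) r → Set
  InRange {n} 𝐒 = ∀ i x → member (lookup 𝐒 i) x ≡ true → x ℕ.+ toℕ i < n

  Covers : ∀ {n} → Vec (Subset n) r → Set
  Covers {n} 𝐒 = ∀ k → k < n → count 𝐒 k ≡ 1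

  Shadowed : ∀ {n} → Vec (Subset n) r → Set
  Shadowed 𝐒 = InRange 𝐒 × Covers 𝐒

  shadowCount≡count : ∀ {n} (𝐒 : Vec (Subset n) r) k → shadowCount 𝐒 k ≡ count 𝐒 k
  shadowCount≡count 𝐒 k = sumℕ-cong _ _ (allFin r) λ {i} _ → sumℕ-cong _ _ (upTo (suc (toℕ i))) λ {j} _ →
    cong (λ b → χ ((j ≤ᵇ k) ∧ b)) (memℕ≡member (lookup 𝐒 i) (k ∸ j))

  elems≡ : ∀ {n} (S : Subset n) → elems S ≡ filterᵇ (member S) (upTo n)
  elems≡ {n} S = filterᵇ-cong _ _ (upTo n) λ {x} _ → memℕ≡member S x

  private
    blockInRangeᵇ : ∀ {n} → Vec (Subset n) r → Fin r → Bool
    blockInRangeᵇ {n} 𝐒 i = BL.all (λ s → s ℕ.+ toℕ i ℕ.<ᵇ n) (elems (lookup 𝐒 i))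
    coveredOnceᵇ : ∀ {n} → Vec (Subset n) r → ℕ → Bool
    coveredOnceᵇ 𝐒 k = shadowCount 𝐒 k ℕ.≡ᵇ 1

  shadowed⇒ : ∀ {n} (𝐒 : Vec (Subset n) r) → IsTrue (isShadowedᵇ 𝐒) → Shadowed 𝐒
  shadowed⇒ {n} 𝐒 sh with Equivalence.to T-∧ sh
  ... | ranges , covers = inRange , covered
    where
    inRange : InRange 𝐒
    inRange i x x∈S = ℕP.<ᵇ⇒< _ n (All.lookup
      (all⁺ (λ s → s ℕ.+ toℕ i ℕ.<ᵇ n) (elems (lookup 𝐒 i)) (All.lookup (all⁺ (blockInRangeᵇ 𝐒) (allFin r) ranges) (∈-allFin i)))
      (subst (x ∈_) (≡.sym (elems≡ (lookup 𝐒 i))) (∈-filterᵇ⁺ _ (∈-upTo⁺ (member-in-range (lookup 𝐒 i) x x∈S)) x∈S)))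
    covered : Covers 𝐒
    covered k k<n = ≡.trans (≡.sym (shadowCount≡count 𝐒 k))
      (ℕP.≡ᵇ⇒≡ _ 1 (All.lookup (all⁺ (coveredOnceᵇ 𝐒) (upTo n) covers) (∈-upTo⁺ k<n)))

  ⇒shadowed : ∀ {n} (𝐒 : Vec (Subset n) r) → Shadowed 𝐒 → IsTrue (isShadowedᵇ 𝐒)
  ⇒shadowed {n} 𝐒 (inRange , covered) = Equivalence.from T-∧
    (all⁻ (blockInRangeᵇ 𝐒) {allFin r} (All.tabulate blockInRange) , all⁻ (coveredOnceᵇ 𝐒) {upTo n} (All.tabulate coveredOnce))
    where
    blockInRange : ∀ {i} → i ∈ allFin r → IsTrue (blockInRangeᵇ 𝐒 i)
    blockInRange {i} _ = all⁻ (λ s → s ℕ.+ toℕ i ℕ.<ᵇ n) {elems (lookup 𝐒 i)} (All.tabulate λ {x} x∈ →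
      let _ , x∈S = ∈-filterᵇ⁻ (member (lookup 𝐒 i)) {upTo n} (subst (x ∈_) (elems≡ (lookup 𝐒 i)) x∈)
      in ℕP.<⇒<ᵇ (inRange i x x∈S))
    coveredOnce : ∀ {k} → k ∈ upTo n → IsTrue (coveredOnceᵇ 𝐒 k)
    coveredOnce {k} k∈ = ℕP.≡⇒≡ᵇ _ 1 (≡.trans (shadowCount≡count 𝐒 k) (covered k (∈-upTo⁻ k∈)))

  -- Insertion.  For t = toℕ i (so i indexes the block S_{t+1}), insertAt i 𝐒′
  -- adds 0 to row i and shifts every row of 𝐒′ by t+1.  Bit x of row j:
  insertBit : ∀ {n′} → Fin r → Fin r → Subset n′ → ℕ → Bool
  insertBit i j S zero    = does (j Fin.≟ i)
  insertBit i j S (suc x) = if toℕ i ≤ᵇ x then member S (x ∸ toℕ i) else false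

  insertAt : ∀ {n n′} → Fin r → Vec (Subset n′) r → Vec (Subset n) r
  insertAt {n} i 𝐒′ = tabulate (λ j → subsetOf n (insertBit i j (lookup 𝐒′ j)))

  member-insertAt : ∀ {n n′} i (𝐒′ : Vec (Subset n′) r) j x → x < n →
                    member (lookup (insertAt {n} i 𝐒′) j) x ≡ insertBit i j (lookup 𝐒′ j) x
  member-insertAt {n} i 𝐒′ j x x<n =
    ≡.trans (cong (λ S → member S x) (VecP.lookup∘tabulate _ j)) (member-subsetOf n _ x x<n)

  insertBit-gap : ∀ {n′} i j (S : Subset n′) x → 0 < x → x ≤ toℕ i → insertBit i j S x ≡ false
  insertBit-gap i j S (suc x) _ x<t = cong (λ b → if b then member S (x ∸ toℕ i) else false) (≤ᵇ-false x<t)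

  insertBit-shifted : ∀ {n′} i j (S : Subset n′) x → insertBit i j S (suc (toℕ i) ℕ.+ x) ≡ member S x
  insertBit-shifted i j S x rewrite ≤ᵇ-true (ℕP.m≤m+n (toℕ i) x) = cong (member S) (ℕP.m+n∸m≡n (toℕ i) x)

  insertBit-initial : ∀ {n′} i j (S : Subset n′) x → x ≤ toℕ i → (x ≡ 0 → j ≢ i) → insertBit i j S x ≡ false
  insertBit-initial i j S zero    _   j≢i = dec-false (j Fin.≟ i) (j≢i refl)
  insertBit-initial i j S (suc x) x≤t _   = insertBit-gap i j S (suc x) (s≤s z≤n) x≤t

  module Insertion {n′ : ℕ} (i : Fin r) (𝐒′ : Vec (Subset n′) r) where
    private
      t = toℕ i
      n = suc t ℕ.+ n′
      row : Fin r → Subset n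
      row j = lookup (insertAt {n} i 𝐒′) j

    hit-shifted : ∀ j k₀ k → k₀ ≤ toℕ j → k < n′ → hit (row j) k₀ (suc t ℕ.+ k) ≡ hit (lookup 𝐒′ j) k₀ k
    hit-shifted j k₀ k k₀≤j k<n′ with k₀ ℕ.≤? k
    ... | yes k₀≤k = begin
        hit (row j) k₀ (suc t ℕ.+ k)                         ≡⟨ hit-member (row j) k₀ _ (ℕP.≤-trans k₀≤k (ℕP.m≤n+m k (suc t))) ⟩
        χ (member (row j) (suc t ℕ.+ k ∸ k₀))                ≡⟨ cong (λ x → χ (member (row j) x)) (ℕP.+-∸-assoc (suc t) k₀≤k) ⟩
        χ (member (row j) (suc t ℕ.+ (k ∸ k₀)))              ≡⟨ cong χ (member-insertAt i 𝐒′ j _ (ℕP.+-monoʳ-< (suc t) (ℕP.≤-<-trans (ℕP.m∸n≤m k k₀) k<n′))) ⟩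
        χ (insertBit i j (lookup 𝐒′ j) (suc t ℕ.+ (k ∸ k₀))) ≡⟨ cong χ (insertBit-shifted i j (lookup 𝐒′ j) (k ∸ k₀)) ⟩
        χ (member (lookup 𝐒′ j) (k ∸ k₀))                    ≡⟨ hit-member (lookup 𝐒′ j) k₀ k k₀≤k ⟨
        hit (lookup 𝐒′ j) k₀ k                               ∎
      where open ≡.≡-Reasoning
    ... | no k₀≰k with k₀ ℕ.≤? suc t ℕ.+ k
    ...   | no k₀≰ = ≡.trans (hit-below (row j) k₀ _ (ℕP.≰⇒> k₀≰)) (≡.sym (hit-below (lookup 𝐒′ j) k₀ k (ℕP.≰⇒> k₀≰k)))
    ...   | yes k₀≤ = ≡.trans (hit-member (row j) k₀ _ k₀≤)
                        (≡.trans (cong χ in-gap) (≡.sym (hit-below (lookup 𝐒′ j) k₀ k (ℕP.≰⇒> k₀≰k))))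
      where
      x = suc t ℕ.+ k ∸ k₀
      x≤t : x ≤ t
      x≤t = ℕP.≤-trans (ℕP.∸-monoʳ-≤ (suc t ℕ.+ k) (ℕP.≰⇒> k₀≰k)) (ℕP.≤-reflexive (ℕP.m+n∸n≡m t k))
      in-gap : member (row j) x ≡ false
      in-gap = ≡.trans (member-insertAt i 𝐒′ j x (ℕP.≤-<-trans (ℕP.m∸n≤m (suc t ℕ.+ k) k₀) (ℕP.+-monoʳ-< (suc t) k<n′)))
                 (insertBit-initial i j (lookup 𝐒′ j) x x≤t λ x≡0 j≡i →
                   ℕP.<⇒≱ (ℕP.≤-trans (ℕP.m≤m+n (suc t) k) (ℕP.m∸n≡0⇒m≤n x≡0)) (subst (λ z → k₀ ≤ toℕ z) j≡i k₀≤j))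

    count-shifted : ∀ k → k < n′ → count (insertAt {n} i 𝐒′) (suc t ℕ.+ k) ≡ count 𝐒′ k
    count-shifted k k<n′ = sumℕ-cong _ _ (allFin r) λ {j} _ → sumℕ-cong _ _ (upTo (suc (toℕ j))) λ {k₀} k₀∈ →
      hit-shifted j k₀ k (ℕP.≤-pred (∈-upTo⁻ k₀∈)) k<n′

    -- each k ≤ t is covered exactly once, by the block S_{t+1} + k
    count-initial : ∀ k → k ≤ t → count (insertAt {n} i 𝐒′) k ≡ 1
    count-initial k k≤t = sumℕ-single _ (Unique.allFin⁺ r) (∈-allFin i)
        (sumℕ-single _ (Unique.upTo⁺ _) (∈-upTo⁺ (s≤s k≤t)) diagonal (λ {k₀} _ k₀≢k → off-diagonal i k₀ (inj₂ k₀≢k)))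
        (λ {j} _ j≢i → sumℕ-zero _ (upTo (suc (toℕ j))) λ {k₀} _ → off-diagonal j k₀ (inj₁ j≢i))
      where
      diagonal : hit (row i) k k ≡ 1
      diagonal = ≡.trans (hit-member (row i) k k ℕP.≤-refl) (cong χ (≡.trans (cong (member (row i)) (ℕP.n∸n≡0 k))
                   (≡.trans (member-insertAt i 𝐒′ i 0 (s≤s z≤n)) (dec-true (i Fin.≟ i) refl))))
      off-diagonal : ∀ j k₀ → (j ≢ i ⊎ k₀ ≢ k) → hit (row j) k₀ k ≡ 0
      off-diagonal j k₀ j≢i⊎k₀≢k with k₀ ℕ.≤? k
      ... | no  k₀≰k = hit-below (row j) k₀ k (ℕP.≰⇒> k₀≰k)
      ... | yes k₀≤k = ≡.trans (hit-member (row j) k₀ k k₀≤k) (cong χ (≡.trans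
            (member-insertAt i 𝐒′ j (k ∸ k₀) (ℕP.≤-<-trans (ℕP.m∸n≤m k k₀) (ℕP.≤-<-trans k≤t (ℕP.m≤m+n (suc t) n′))))
            (insertBit-initial i j _ (k ∸ k₀) (ℕP.≤-trans (ℕP.m∸n≤m k k₀) k≤t) (distinct j≢i⊎k₀≢k))))
        where
        distinct : (j ≢ i ⊎ k₀ ≢ k) → k ∸ k₀ ≡ 0 → j ≢ i
        distinct (inj₁ j≢i) _          = j≢i
        distinct (inj₂ k₀≢k) k∸k₀≡0 _ = k₀≢k (ℕP.≤-antisym k₀≤k (ℕP.m∸n≡0⇒m≤n k∸k₀≡0))

    insertAt-Covers : Covers 𝐒′ → Covers (insertAt {n} i 𝐒′)
    insertAt-Covers covers k k<n with k ℕ.≤? t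
    ... | yes k≤t = count-initial k k≤t
    ... | no  k≰t = begin
        count (insertAt {n} i 𝐒′) k                          ≡⟨ cong (count (insertAt {n} i 𝐒′)) (ℕP.m+[n∸m]≡n t<k) ⟨
        count (insertAt {n} i 𝐒′) (suc t ℕ.+ (k ∸ suc t))    ≡⟨ count-shifted (k ∸ suc t) k′<n′ ⟩
        count 𝐒′ (k ∸ suc t)                                 ≡⟨ covers _ k′<n′ ⟩
        1                                                    ∎
      where
      open ≡.≡-Reasoning
      t<k : suc t ≤ k
      t<k = ℕP.≰⇒> k≰t
      k′<n′ : k ∸ suc t < n′
      k′<n′ = ℕP.+-cancelˡ-< (suc t) _ _ (subst (_< n) (≡.sym (ℕP.m+[n∸m]≡n t<k)) k<n)

    insertAt-InRange : InRange 𝐒′ → InRange (insertAt {n} i 𝐒′)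
    insertAt-InRange inRange j x x∈ with ≡.trans (≡.sym (member-insertAt i 𝐒′ j x (member-in-range (row j) x x∈))) x∈
    insertAt-InRange inRange j zero    x∈ | j≡i with j Fin.≟ i
    ... | yes refl = s≤s (ℕP.m≤m+n t n′)
    insertAt-InRange inRange j zero    x∈ | () | no _
    insertAt-InRange inRange j (suc y) x∈ | y∈ with t ≤ᵇ y in t≤ᵇy
    ... | true = subst (λ z → suc z ℕ.+ toℕ j < n) (ℕP.m+[n∸m]≡n t≤y)
                   (subst (_< n) (≡.sym (ℕP.+-assoc (suc t) (y ∸ t) (toℕ j))) (ℕP.+-monoʳ-< (suc t) (inRange j (y ∸ t) y∈)))
      where t≤y = ≤ᵇ-sound {t} {y} t≤ᵇy
    insertAt-InRange inRange j (suc y) x∈ | () | false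

  -- The facts above for any n of the form t+1+n′ (in P_r(n) the inserted
  -- tuples come from P_r(n ∸ (t+1))).
  insertAt-Shadowed : ∀ {n n′} i → n ≡ suc (toℕ i) ℕ.+ n′ → (𝐒′ : Vec (Subset n′) r) →
                      Shadowed 𝐒′ → Shadowed (insertAt {n} i 𝐒′)
  insertAt-Shadowed i refl 𝐒′ (inRange , covers) =
    Insertion.insertAt-InRange i 𝐒′ inRange , Insertion.insertAt-Covers i 𝐒′ covers

  count-insertAt : ∀ {n n′} i → n ≡ suc (toℕ i) ℕ.+ n′ → (𝐒′ : Vec (Subset n′) r) →
                   ∀ k → k < n′ → count (insertAt {n} i 𝐒′) (suc (toℕ i) ℕ.+ k) ≡ count 𝐒′ k
  count-insertAt i refl 𝐒′ = Insertion.count-shifted i 𝐒′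

  two-hits : ∀ {n} (𝐒 : Vec (Subset n) r) a b j j′ k → j ≤ toℕ a → j′ ≤ toℕ b → (a ≢ b ⊎ j ≢ j′) →
             hit (lookup 𝐒 a) j k ≡ 1 → hit (lookup 𝐒 b) j′ k ≡ 1 → 2 ≤ count 𝐒 k
  two-hits 𝐒 a b j j′ k j≤a j′≤b distinct hitA hitB with a Fin.≟ b
  ... | yes refl = ℕP.≤-trans (subst (_≤ rowCount 𝐒 a k) (cong₂ ℕ._+_ hitA hitB)
                     (two-terms≤sumℕ (λ j → hit (lookup 𝐒 a) j k) (∈-upTo⁺ (s≤s j≤a)) (∈-upTo⁺ (s≤s j′≤b)) (same-row distinct)))
                     (term≤sumℕ (λ i → rowCount 𝐒 i k) (∈-allFin a))
    where
    same-row : (a ≢ a ⊎ j ≢ j′) → j ≢ j′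
    same-row (inj₁ a≢a)  = ⊥-elim (a≢a refl)
    same-row (inj₂ j≢j′) = j≢j′
  ... | no a≢b = ℕP.≤-trans
      (ℕP.+-mono-≤ (subst (_≤ rowCount 𝐒 a k) hitA (term≤sumℕ (λ j → hit (lookup 𝐒 a) j k) (∈-upTo⁺ (s≤s j≤a))))
                   (subst (_≤ rowCount 𝐒 b k) hitB (term≤sumℕ (λ j → hit (lookup 𝐒 b) j k) (∈-upTo⁺ (s≤s j′≤b)))))
      (two-terms≤sumℕ (λ i → rowCount 𝐒 i k) (∈-allFin a) (∈-allFin b) a≢b)

  split : ∀ {n₀} (𝐒 : Vec (Subset (suc n₀)) r) → Shadowed 𝐒 →
          Σ[ i ∈ Fin r ] Σ[ t<n ∈ suc (toℕ i) ≤ suc n₀ ] Σ[ 𝐒′ ∈ Vec (Subset (suc n₀ ∸ suc (toℕ i))) r ]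
            (Shadowed 𝐒′ × 𝐒 ≡ insertAt i 𝐒′)
  split {n₀} 𝐒 (inRange , covers)
    with positive-term _ (allFin r) (subst (0 <_) (≡.sym (covers 0 (s≤s z≤n))) (s≤s z≤n))
  ... | i , _ , row-hits-0 with positive-term _ (upTo (suc (toℕ i))) row-hits-0
  ...   | suc j , _ , hits = ⊥-elim (ℕP.<-irrefl refl (subst (0 <_) (hit-below (lookup 𝐒 i) (suc j) 0 (s≤s z≤n)) hits))
  ...   | zero  , _ , hits = i , t<n , 𝐒′ , (inRange′ , covers′) , 𝐒≡
    where
    n = suc n₀
    t = toℕ i
    0∈Sᵢ : member (lookup 𝐒 i) 0 ≡ true
    0∈Sᵢ = χ-positive hits
    t<n : suc t ≤ n
    t<n = inRange i 0 0∈Sᵢ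
    n′ = n ∸ suc t
    n≡ : n ≡ suc t ℕ.+ n′
    n≡ = ≡.sym (ℕP.m+[n∸m]≡n t<n)
    𝐒′ : Vec (Subset n′) r
    𝐒′ = tabulate (λ j → subsetOf n′ (λ x → member (lookup 𝐒 j) (suc t ℕ.+ x)))
    member-𝐒′ : ∀ j x → x < n′ → member (lookup 𝐒′ j) x ≡ member (lookup 𝐒 j) (suc t ℕ.+ x)
    member-𝐒′ j x x<n′ = ≡.trans (cong (λ S → member S x) (VecP.lookup∘tabulate _ j)) (member-subsetOf n′ _ x x<n′)
    hit-at-0 : ∀ j k → member (lookup 𝐒 j) k ≡ true → hit (lookup 𝐒 j) 0 k ≡ 1
    hit-at-0 j k k∈ = ≡.trans (hit-member (lookup 𝐒 j) 0 k z≤n) (cong χ k∈)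
    hit-diagonal : ∀ k → hit (lookup 𝐒 i) k k ≡ 1
    hit-diagonal k = ≡.trans (hit-member (lookup 𝐒 i) k k ℕP.≤-refl) (cong χ (≡.trans (cong (member (lookup 𝐒 i)) (ℕP.n∸n≡0 k)) 0∈Sᵢ))
    not-twice : ∀ k → k < n → ¬ (2 ≤ count 𝐒 k)
    not-twice k k<n 2≤ = ℕP.<-irrefl refl (subst (2 ≤_) (covers k k<n) 2≤)
    absent : ∀ {b} → (b ≡ true → ⊥) → b ≡ false
    absent {true}  b≢true = ⊥-elim (b≢true refl)
    absent {false} _      = refl
    agrees : ∀ j x → x < n → member (lookup 𝐒 j) x ≡ insertBit i j (lookup 𝐒′ j) x
    agrees j zero x<n with j Fin.≟ i
    ... | yes refl = 0∈Sᵢ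
    ... | no  j≢i  = absent λ 0∈Sⱼ → not-twice 0 x<n
                       (two-hits 𝐒 j i 0 0 0 z≤n z≤n (inj₁ j≢i) (hit-at-0 j 0 0∈Sⱼ) (hit-diagonal 0))
    agrees j (suc y) x<n with y ℕ.<? t
    ... | yes y<t = ≡.trans (absent λ y+1∈Sⱼ → not-twice (suc y) x<n
                      (two-hits 𝐒 j i 0 (suc y) (suc y) z≤n y<t (inj₂ (λ ())) (hit-at-0 j (suc y) y+1∈Sⱼ) (hit-diagonal (suc y))))
                      (≡.sym (insertBit-gap i j (lookup 𝐒′ j) (suc y) (s≤s z≤n) y<t))
    ... | no  y≮t = ≡.sym (begin
        insertBit i j (lookup 𝐒′ j) (suc y)        ≡⟨ cong (λ b → if b then member (lookup 𝐒′ j) (y ∸ t) else false) (≤ᵇ-true t≤y) ⟩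
        member (lookup 𝐒′ j) (y ∸ t)               ≡⟨ member-𝐒′ j (y ∸ t) y∸t<n′ ⟩
        member (lookup 𝐒 j) (suc t ℕ.+ (y ∸ t))    ≡⟨ cong (λ z → member (lookup 𝐒 j) (suc z)) (ℕP.m+[n∸m]≡n t≤y) ⟩
        member (lookup 𝐒 j) (suc y)                ∎)
      where
      open ≡.≡-Reasoning
      t≤y : t ≤ y
      t≤y = ℕP.≮⇒≥ y≮t
      y∸t<n′ : y ∸ t < n′
      y∸t<n′ = ℕP.+-cancelˡ-< (suc t) _ _ (subst (_< suc t ℕ.+ n′) (cong suc (≡.sym (ℕP.m+[n∸m]≡n t≤y))) (subst (suc y <_) n≡ x<n))
    𝐒≡ : 𝐒 ≡ insertAt i 𝐒′
    𝐒≡ = tuple-ext 𝐒 (insertAt i 𝐒′) λ j → subset-ext _ _ λ x x<n →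
           ≡.trans (agrees j x x<n) (≡.sym (member-insertAt i 𝐒′ j x x<n))
    inRange′ : InRange 𝐒′
    inRange′ j x x∈ = ℕP.+-cancelˡ-< (suc t) _ _ (subst (suc t ℕ.+ (x ℕ.+ toℕ j) <_) n≡
      (subst (_< n) (ℕP.+-assoc (suc t) x (toℕ j))
        (inRange j (suc t ℕ.+ x) (≡.trans (≡.sym (member-𝐒′ j x (member-in-range (lookup 𝐒′ j) x x∈))) x∈))))
    covers′ : Covers 𝐒′
    covers′ k k<n′ = begin
        count 𝐒′ k                                 ≡⟨ count-insertAt i n≡ 𝐒′ k k<n′ ⟨
        count (insertAt i 𝐒′) (suc t ℕ.+ k)        ≡⟨ cong (λ 𝐓 → count 𝐓 (suc t ℕ.+ k)) 𝐒≡ ⟨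
        count 𝐒 (suc t ℕ.+ k)                      ≡⟨ covers _ (subst (suc t ℕ.+ k <_) (≡.sym n≡) (ℕP.+-monoʳ-< (suc t) k<n′)) ⟩
        1                                          ∎
      where open ≡.≡-Reasoning

∈-concatMap : ∀ {a b} {A : Set a} {B : Set b} (f : A → List B) {xs x y} → x ∈ xs → y ∈ f x → y ∈ concatMap f xs
∈-concatMap f x∈ y∈ = ∈-concatMap⁺ f (Any.map (λ { refl → y∈ }) x∈)

concatMap-unique : ∀ {a b} {A : Set a} {B : Set b} (f : A → List B) {xs} → Unique xs →
  (∀ {x} → x ∈ xs → Unique (f x)) → (∀ {x y z} → x ∈ xs → y ∈ xs → z ∈ f x → z ∈ f y → x ≡ y) →
  Unique (concatMap f xs)
concatMap-unique f {[]}     _          _       _        = []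
concatMap-unique f {x ∷ xs} (x∉ ∷ uxs) uniqueF disjoint =
  Unique.++⁺ (uniqueF (here refl))
    (concatMap-unique f uxs (λ x∈ → uniqueF (there x∈)) (λ x∈ y∈ → disjoint (there x∈) (there y∈)))
    λ (z∈fx , z∈rest) → let y , y∈ , z∈fy = find (∈-concatMap⁻ f z∈rest) in
      All¬⇒¬Any x∉ (subst (_∈ xs) (≡.sym (disjoint (here refl) (there y∈) z∈fx z∈fy)) y∈)

allSubsets-complete : ∀ {n} (S : Subset n) → S ∈ allSubsets n
allSubsets-complete []          = here refl
allSubsets-complete (false ∷ S) = ∈-concatMap _ (allSubsets-complete S) (here refl)
allSubsets-complete (true  ∷ S) = ∈-concatMap _ (allSubsets-complete S) (there (here refl))

allSubsets-unique : ∀ n → Unique (allSubsets n)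
allSubsets-unique zero    = [] ∷ []
allSubsets-unique (suc n) = concatMap-unique _ (allSubsets-unique n) (λ _ → ((λ ()) ∷ []) ∷ [] ∷ []) same-tail
  where
  same-tail : ∀ {S S′ : Subset n} {z} → S ∈ allSubsets n → S′ ∈ allSubsets n →
              z ∈ (false ∷ S) ∷ (true ∷ S) ∷ [] → z ∈ (false ∷ S′) ∷ (true ∷ S′) ∷ [] → S ≡ S′
  same-tail _ _ (here refl)         (here refl)         = refl
  same-tail _ _ (there (here refl)) (there (here refl)) = refl
  same-tail _ _ (here refl)         (there (here ()))
  same-tail _ _ (there (here refl)) (here ())

allTuples-complete : ∀ {r n} (𝐒 : Vec (Subset n) r) → 𝐒 ∈ allTuples r n
allTuples-complete []      = here refl
allTuples-complete (S ∷ 𝐒) = ∈-concatMap _ (allSubsets-complete S) (∈-map⁺ (S ∷_) (allTuples-complete 𝐒))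

allTuples-unique : ∀ r n → Unique (allTuples r n)
allTuples-unique zero    n = [] ∷ []
allTuples-unique (suc r) n = concatMap-unique _ (allSubsets-unique n)
  (λ _ → Unique.map⁺ VecP.∷-injectiveʳ (allTuples-unique r n))
  λ _ _ z∈x z∈y → let _ , _ , z≡x∷ = ∈-map⁻ _ z∈x ; _ , _ , z≡y∷ = ∈-map⁻ _ z∈y in
    VecP.∷-injectiveˡ (≡.trans (≡.sym z≡x∷) z≡y∷)

P-unique : ∀ r n → Unique (P r n)
P-unique r n = Unique.filter⁺ _ (allTuples-unique r n)

∈P⁺ : ∀ {r n} (𝐒 : Vec (Subset n) r) → IsTrue (isShadowedᵇ 𝐒) → 𝐒 ∈ P r n
∈P⁺ 𝐒 sh = ∈-filter⁺ (λ 𝐒 → T? (isShadowedᵇ 𝐒)) (allTuples-complete 𝐒) sh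

∈P⁻ : ∀ {r n} {𝐒 : Vec (Subset n) r} → 𝐒 ∈ P r n → IsTrue (isShadowedᵇ 𝐒)
∈P⁻ {r} {n} 𝐒∈ = proj₂ (∈-filter⁻ (λ 𝐒 → T? (isShadowedᵇ 𝐒)) {xs = allTuples r n} 𝐒∈)

module Decomposition {r : ℕ} where
  open ShadowedPartitions {r}

  block : ∀ n → Fin r → List (Vec (Subset n) r)
  block n i = if suc (toℕ i) ≤ᵇ n then map (insertAt i) (P r (n ∸ suc (toℕ i))) else []

  blocks : ∀ n → List (Vec (Subset n) r)
  blocks n = concatMap (block n) (allFin r)

  ∈block⁻ : ∀ n i {𝐒} → 𝐒 ∈ block n i →
            suc (toℕ i) ≤ n × Σ[ 𝐒′ ∈ _ ] (𝐒′ ∈ P r (n ∸ suc (toℕ i)) × 𝐒 ≡ insertAt i 𝐒′)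
  ∈block⁻ n i 𝐒∈ with suc (toℕ i) ≤ᵇ n in i<n
  ... | true = ≤ᵇ-sound i<n , ∈-map⁻ (insertAt i) 𝐒∈

  ∈block⁺ : ∀ n i 𝐒′ → suc (toℕ i) ≤ n → 𝐒′ ∈ P r (n ∸ suc (toℕ i)) → insertAt i 𝐒′ ∈ block n i
  ∈block⁺ n i 𝐒′ i<n 𝐒′∈ rewrite ≤ᵇ-true i<n = ∈-map⁺ (insertAt i) 𝐒′∈

  -- insertAt i is injective: 𝐒′ is read off beyond position i
  insertAt-injective : ∀ {n} i → suc (toℕ i) ≤ n → (𝐒₁ 𝐒₂ : Vec (Subset (n ∸ suc (toℕ i))) r) →
                       insertAt {n} i 𝐒₁ ≡ insertAt i 𝐒₂ → 𝐒₁ ≡ 𝐒₂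
  insertAt-injective {n} i i<n 𝐒₁ 𝐒₂ eq = tuple-ext _ _ λ j → subset-ext _ _ λ x x< → begin
      member (lookup 𝐒₁ j) x                                    ≡⟨ insertBit-shifted i j (lookup 𝐒₁ j) x ⟨
      insertBit i j (lookup 𝐒₁ j) (suc (toℕ i) ℕ.+ x)           ≡⟨ member-insertAt i 𝐒₁ j _ (in-range x x<) ⟨
      member (lookup (insertAt {n} i 𝐒₁) j) (suc (toℕ i) ℕ.+ x) ≡⟨ cong (λ 𝐓 → member (lookup 𝐓 j) (suc (toℕ i) ℕ.+ x)) eq ⟩
      member (lookup (insertAt {n} i 𝐒₂) j) (suc (toℕ i) ℕ.+ x) ≡⟨ member-insertAt i 𝐒₂ j _ (in-range x x<) ⟩
      insertBit i j (lookup 𝐒₂ j) (suc (toℕ i) ℕ.+ x)           ≡⟨ insertBit-shifted i j (lookup 𝐒₂ j) x ⟩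
      member (lookup 𝐒₂ j) x                                    ∎
    where
    open ≡.≡-Reasoning
    in-range : ∀ x → x < n ∸ suc (toℕ i) → suc (toℕ i) ℕ.+ x < n
    in-range x x< = subst (suc (toℕ i) ℕ.+ x <_) (ℕP.m+[n∸m]≡n i<n) (ℕP.+-monoʳ-< (suc (toℕ i)) x<)

  -- row j of insertAt i 𝐒′ contains 0 iff j = i, so different blocks are disjoint
  blocks-unique : ∀ n → Unique (blocks n)
  blocks-unique n = concatMap-unique (block n) (Unique.allFin⁺ r) unique-block disjoint
    where
    unique-block : ∀ {i} → i ∈ allFin r → Unique (block n i)
    unique-block {i} _ with suc (toℕ i) ≤ᵇ n in i<n
    ... | true  = Unique.map⁺ (λ {𝐒₁} {𝐒₂} → insertAt-injective i (≤ᵇ-sound i<n) 𝐒₁ 𝐒₂) (P-unique r _)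
    ... | false = []
    0∈row : ∀ {n′} a j (𝐒′ : Vec (Subset n′) r) → 0 < n → member (lookup (insertAt {n} a 𝐒′) j) 0 ≡ does (j Fin.≟ a)
    0∈row a j 𝐒′ 0<n = member-insertAt a 𝐒′ j 0 0<n
    disjoint : ∀ {a b 𝐒} → a ∈ allFin r → b ∈ allFin r → 𝐒 ∈ block n a → 𝐒 ∈ block n b → a ≡ b
    disjoint {a} {b} _ _ 𝐒∈a 𝐒∈b with ∈block⁻ n a 𝐒∈a | ∈block⁻ n b 𝐒∈b
    ... | a<n , 𝐒a , _ , refl | _ , 𝐒b , _ , eq with a Fin.≟ b
    ...   | yes a≡b = a≡b
    ...   | no  a≢b = ⊥-elim (true≢false (begin
        true                                        ≡⟨ dec-true (a Fin.≟ a) refl ⟨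
        does (a Fin.≟ a)                            ≡⟨ 0∈row a a 𝐒a 0<n ⟨
        member (lookup (insertAt {n} a 𝐒a) a) 0     ≡⟨ cong (λ 𝐓 → member (lookup 𝐓 a) 0) eq ⟩
        member (lookup (insertAt {n} b 𝐒b) a) 0     ≡⟨ 0∈row b a 𝐒b 0<n ⟩
        does (a Fin.≟ b)                            ≡⟨ dec-false (a Fin.≟ b) a≢b ⟩
        false                                       ∎))
      where
      open ≡.≡-Reasoning
      0<n = ℕP.≤-trans (s≤s z≤n) a<n
      true≢false : true ≢ false
      true≢false ()

  blocks⊆P : ∀ n {𝐒} → 𝐒 ∈ blocks n → 𝐒 ∈ P r n
  blocks⊆P n 𝐒∈ with find (∈-concatMap⁻ (block n) {xs = allFin r} 𝐒∈)
  ... | i , _ , 𝐒∈block with ∈block⁻ n i 𝐒∈block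
  ...   | i<n , 𝐒′ , 𝐒′∈ , refl =
    ∈P⁺ (insertAt i 𝐒′) (⇒shadowed (insertAt {n} i 𝐒′) (insertAt-Shadowed i (≡.sym (ℕP.m+[n∸m]≡n i<n)) 𝐒′ (shadowed⇒ 𝐒′ (∈P⁻ 𝐒′∈))))

  P⊆blocks : ∀ n₀ {𝐒} → 𝐒 ∈ P r (suc n₀) → 𝐒 ∈ blocks (suc n₀)
  P⊆blocks n₀ {𝐒} 𝐒∈ with split 𝐒 (shadowed⇒ 𝐒 (∈P⁻ 𝐒∈))
  ... | i , i<n , 𝐒′ , 𝐒′-shadowed , refl =
    ∈-concatMap (block (suc n₀)) (∈-allFin i) (∈block⁺ (suc n₀) i 𝐒′ i<n (∈P⁺ 𝐒′ (⇒shadowed 𝐒′ 𝐒′-shadowed)))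

size-elems : ∀ {n} (S : Subset n) → ∣ S ∣ ≡ length (filterᵇ (member S) (upTo n))
size-elems []              = refl
size-elems {suc n} (b ∷ S) = by-head b
  where
  tail-count : ∀ b → length (filterᵇ (member (b ∷ S)) (applyUpTo suc n)) ≡ ∣ S ∣
  tail-count b = begin
    length (filterᵇ (member (b ∷ S)) (applyUpTo suc n))  ≡⟨ cong (λ xs → length (filterᵇ (member (b ∷ S)) xs)) (ListP.map-upTo suc n) ⟨
    length (filterᵇ (member (b ∷ S)) (map suc (upTo n))) ≡⟨ cong length (filterᵇ-map (member (b ∷ S)) suc (upTo n)) ⟩
    length (map suc (filterᵇ (member S) (upTo n)))       ≡⟨ ListP.length-map suc (filterᵇ (member S) (upTo n)) ⟩
    length (filterᵇ (member S) (upTo n))                 ≡⟨ size-elems S ⟨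
    ∣ S ∣                                                ∎
    where open ≡.≡-Reasoning
  by-head : ∀ b → ∣ b ∷ S ∣ ≡ length (filterᵇ (member (b ∷ S)) (upTo (suc n)))
  by-head true  = cong suc (≡.sym (tail-count true))
  by-head false = ≡.sym (tail-count false)

module InsertionStatistics {r : ℕ} where
  open ShadowedPartitions {r}

  δ : Fin r → Fin r → ℕ
  δ i j = χ (does (j Fin.≟ i))

  Σδ≡1 : ∀ i → sumℕ (map (δ i) (allFin r)) ≡ 1
  Σδ≡1 i = sumℕ-single (δ i) (Unique.allFin⁺ r) (∈-allFin i) (cong χ (dec-true (i Fin.≟ i) refl))
    λ {j} _ j≢i → cong χ (dec-false (j Fin.≟ i) j≢i)

  private
    [0]-if : Bool → List ℕ
    [0]-if b = if b then [ 0 ] else []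

    any-cong : ∀ {a} {A : Set a} (f g : A → Bool) xs → (∀ x → f x ≡ g x) → BL.any f xs ≡ BL.any g xs
    any-cong f g xs f≡g = cong BL.or (ListP.map-cong f≡g xs)

    any-false : ∀ {a} {A : Set a} (f : A → Bool) xs → (∀ x → f x ≡ false) → BL.any f xs ≡ false
    any-false f []       _   = refl
    any-false f (x ∷ xs) f≡0 rewrite f≡0 x = any-false f xs f≡0

    any-true : ∀ {a} {A : Set a} (f : A → Bool) {xs x} → x ∈ xs → f x ≡ true → BL.any f xs ≡ true
    any-true f x∈ fx = Equivalence.to T-≡ (any⁺ f (Any.map (λ { refl → Equivalence.from T-≡ fx }) x∈))

  module _ {n′ : ℕ} (i : Fin r) (𝐒′ : Vec (Subset n′) r) where
    private
      t = toℕ i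
      n = suc t ℕ.+ n′
      row : Fin r → Subset n
      row j = lookup (insertAt {n} i 𝐒′) j
      gap : ∀ j x → 0 < x → x ≤ t → member (row j) x ≡ false
      gap j x 0<x x≤t = ≡.trans (member-insertAt i 𝐒′ j x (s≤s (ℕP.≤-trans x≤t (ℕP.m≤m+n t n′)))) (insertBit-gap i j _ x 0<x x≤t)
      shifted : ∀ j x → x < n′ → member (row j) (suc t ℕ.+ x) ≡ member (lookup 𝐒′ j) x
      shifted j x x<n′ = ≡.trans (member-insertAt i 𝐒′ j _ (ℕP.+-monoʳ-< (suc t) x<n′)) (insertBit-shifted i j (lookup 𝐒′ j) x)
      initial : ∀ j → member (row j) 0 ≡ does (j Fin.≟ i)
      initial j = member-insertAt i 𝐒′ j 0 (s≤s z≤n)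

    row-elements : ∀ j → filterᵇ (member (row j)) (upTo n) ≡
                   [0]-if (does (j Fin.≟ i)) ++ map (suc t ℕ.+_) (filterᵇ (member (lookup 𝐒′ j)) (upTo n′))
    row-elements j = ≡.trans (filterᵇ-shifted t n′ (member (row j)) (member (lookup 𝐒′ j)) (gap j) (shifted j))
      (cong (λ b → [0]-if b ++ map (suc t ℕ.+_) (filterᵇ (member (lookup 𝐒′ j)) (upTo n′))) (initial j))

    size-insertAt : size (insertAt {n} i 𝐒′) ≡ suc (size 𝐒′)
    size-insertAt = begin
      sumℕ (map (λ j → ∣ row j ∣) (allFin r))                        ≡⟨ sumℕ-cong _ _ (allFin r) (λ {j} _ → row-size j) ⟩
      sumℕ (map (λ j → δ i j ℕ.+ ∣ lookup 𝐒′ j ∣) (allFin r))        ≡⟨ sumℕ-+ (δ i) _ (allFin r) ⟩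
      sumℕ (map (δ i) (allFin r)) ℕ.+ size 𝐒′                        ≡⟨ cong (ℕ._+ size 𝐒′) (Σδ≡1 i) ⟩
      suc (size 𝐒′)                                                  ∎
      where
      open ≡.≡-Reasoning
      row-size : ∀ j → ∣ row j ∣ ≡ δ i j ℕ.+ ∣ lookup 𝐒′ j ∣
      row-size j = begin
        ∣ row j ∣                                                   ≡⟨ size-elems (row j) ⟩
        length (filterᵇ (member (row j)) (upTo n))                  ≡⟨ cong length (row-elements j) ⟩
        length ([0]-if (does (j Fin.≟ i)) ++ map (suc t ℕ.+_) E)    ≡⟨ ListP.length-++ ([0]-if (does (j Fin.≟ i))) ⟩
        length ([0]-if (does (j Fin.≟ i))) ℕ.+ length (map (suc t ℕ.+_) E) ≡⟨ cong₂ ℕ._+_ (length-[0]-if (does (j Fin.≟ i))) (ListP.length-map _ E) ⟩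
        δ i j ℕ.+ length E                                          ≡⟨ cong (δ i j ℕ.+_) (size-elems (lookup 𝐒′ j)) ⟨
        δ i j ℕ.+ ∣ lookup 𝐒′ j ∣                                   ∎
        where
        E = filterᵇ (member (lookup 𝐒′ j)) (upTo n′)
        length-[0]-if : ∀ b → length ([0]-if b) ≡ χ b
        length-[0]-if true  = refl
        length-[0]-if false = refl

    w-insertAt : ∀ q j → w q (row j) ≡ δ i j ℕ.+ q ℕ.^ suc t ℕ.* w q (lookup 𝐒′ j)
    w-insertAt q j = begin
      sumℕ (map (q ℕ.^_) (elems (row j)))                                                   ≡⟨ cong (λ xs → sumℕ (map (q ℕ.^_) xs)) (≡.trans (elems≡ (row j)) (row-elements j)) ⟩
      sumℕ (map (q ℕ.^_) ([0]-if b ++ map (suc t ℕ.+_) E))                                  ≡⟨ cong sumℕ (ListP.map-++ (q ℕ.^_) ([0]-if b) _) ⟩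
      sumℕ (map (q ℕ.^_) ([0]-if b) ++ map (q ℕ.^_) (map (suc t ℕ.+_) E))                   ≡⟨ sum-++ (map (q ℕ.^_) ([0]-if b)) _ ⟩
      sumℕ (map (q ℕ.^_) ([0]-if b)) ℕ.+ sumℕ (map (q ℕ.^_) (map (suc t ℕ.+_) E))           ≡⟨ cong₂ ℕ._+_ (weight-[0]-if b) (cong sumℕ (≡.sym (ListP.map-∘ E))) ⟩
      δ i j ℕ.+ sumℕ (map (λ x → q ℕ.^ (suc t ℕ.+ x)) E)                                    ≡⟨ cong (δ i j ℕ.+_) (sumℕ-cong _ _ E (λ {x} _ → ℕP.^-distribˡ-+-* q (suc t) x)) ⟩
      δ i j ℕ.+ sumℕ (map (λ x → q ℕ.^ suc t ℕ.* q ℕ.^ x) E)                                ≡⟨ cong (δ i j ℕ.+_) (sumℕ-*ˡ (q ℕ.^ suc t) (q ℕ.^_) E) ⟩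
      δ i j ℕ.+ q ℕ.^ suc t ℕ.* sumℕ (map (q ℕ.^_) E)                                       ≡⟨ cong (λ xs → δ i j ℕ.+ q ℕ.^ suc t ℕ.* sumℕ (map (q ℕ.^_) xs)) (elems≡ (lookup 𝐒′ j)) ⟨
      δ i j ℕ.+ q ℕ.^ suc t ℕ.* w q (lookup 𝐒′ j)                                           ∎
      where
      open ≡.≡-Reasoning
      b = does (j Fin.≟ i)
      E = filterᵇ (member (lookup 𝐒′ j)) (upTo n′)
      weight-[0]-if : ∀ b → sumℕ (map (q ℕ.^_) ([0]-if b)) ≡ χ b
      weight-[0]-if true  = refl
      weight-[0]-if false = refl

    union-insertAt : unionWithN (insertAt {n} i 𝐒′) ≡ 0 ∷ map (suc t ℕ.+_) (unionWithN 𝐒′)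
    union-insertAt = begin
      filterᵇ (inUnion (insertAt {n} i 𝐒′)) (upTo n) ++ [ n ]                                      ≡⟨ cong (_++ [ n ]) union-elements ⟩
      ([0]-if (inUnion (insertAt {n} i 𝐒′) 0) ++ map (suc t ℕ.+_) U′) ++ [ n ]                     ≡⟨ cong (λ b → ([0]-if b ++ map (suc t ℕ.+_) U′) ++ [ n ]) 0∈union ⟩
      0 ∷ (map (suc t ℕ.+_) U′ ++ map (suc t ℕ.+_) [ n′ ])                                         ≡⟨ cong (0 ∷_) (ListP.map-++ (suc t ℕ.+_) U′ _) ⟨
      0 ∷ map (suc t ℕ.+_) (U′ ++ [ n′ ])                                                          ∎
      where
      open ≡.≡-Reasoning
      inUnion : ∀ {m} → Vec (Subset m) r → ℕ → Bool
      inUnion 𝐒 k = BL.any (λ j → memℕ (lookup 𝐒 j) k) (allFin r)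
      U′ = filterᵇ (inUnion 𝐒′) (upTo n′)
      union-elements : filterᵇ (inUnion (insertAt {n} i 𝐒′)) (upTo n) ≡
                       [0]-if (inUnion (insertAt {n} i 𝐒′) 0) ++ map (suc t ℕ.+_) U′
      union-elements = filterᵇ-shifted t n′ _ _
        (λ x 0<x x≤t → any-false _ (allFin r) λ j → ≡.trans (memℕ≡member (row j) x) (gap j x 0<x x≤t))
        (λ x x<n′ → any-cong _ _ (allFin r) λ j →
           ≡.trans (memℕ≡member (row j) _) (≡.trans (shifted j x x<n′) (≡.sym (memℕ≡member (lookup 𝐒′ j) x))))
      0∈union : inUnion (insertAt {n} i 𝐒′) 0 ≡ true
      0∈union = any-true _ (∈-allFin i) (≡.trans (memℕ≡member (row i) 0) (≡.trans (initial i) (dec-true (i Fin.≟ i) refl)))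

  size-insertAt′ : ∀ {n n′} i → n ≡ suc (toℕ i) ℕ.+ n′ → (𝐒′ : Vec (Subset n′) r) →
                   size (insertAt {n} i 𝐒′) ≡ suc (size 𝐒′)
  size-insertAt′ i refl 𝐒′ = size-insertAt i 𝐒′

  w-insertAt′ : ∀ {n n′} i → n ≡ suc (toℕ i) ℕ.+ n′ → (𝐒′ : Vec (Subset n′) r) → ∀ q j →
                w q (lookup (insertAt {n} i 𝐒′) j) ≡ δ i j ℕ.+ q ℕ.^ suc (toℕ i) ℕ.* w q (lookup 𝐒′ j)
  w-insertAt′ i refl 𝐒′ = w-insertAt i 𝐒′

  union-insertAt′ : ∀ {n n′} i → n ≡ suc (toℕ i) ℕ.+ n′ → (𝐒′ : Vec (Subset n′) r) →
                    unionWithN (insertAt {n} i 𝐒′) ≡ 0 ∷ map (suc (toℕ i) ℕ.+_) (unionWithN 𝐒′)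
  union-insertAt′ i refl 𝐒′ = union-insertAt i 𝐒′

module EmptyPartition {r : ℕ} where
  open ShadowedPartitions {r}

  ∅ : Vec (Subset 0) r
  ∅ = Vec.replicate r []

  P₀ : P r 0 ≡ ∅ ∷ []
  P₀ = ≡.trans (cong (filter (λ 𝐒 → T? (isShadowedᵇ 𝐒))) (only-tuple r))
               (ListP.filter-accept (λ 𝐒 → T? (isShadowedᵇ 𝐒)) (⇒shadowed ∅ ((λ j x x∈ → ⊥-elim (empty (lookup ∅ j) x x∈)) , λ _ ())))
    where
    only-tuple : ∀ r′ → allTuples r′ 0 ≡ Vec.replicate r′ [] ∷ []
    only-tuple zero     = refl
    only-tuple (suc r′) rewrite only-tuple r′ = refl
    empty : (S : Subset 0) → ∀ x → member S x ≢ true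
    empty [] x ()

  size-∅ : size ∅ ≡ 0
  size-∅ = sumℕ-zero _ (allFin r) λ {j} _ → no-elements (lookup ∅ j)
    where
    no-elements : (S : Subset 0) → ∣ S ∣ ≡ 0
    no-elements [] = refl

  w-∅ : ∀ q j → w q (lookup ∅ j) ≡ 0
  w-∅ q j with lookup ∅ j
  ... | [] = refl

-- L has characteristic p, since it contains the field 𝔽_q with q = p^k
-- elements; hence x ↦ x^{q^m} is additive on L.
module FrobeniusOnL {c ℓ : Level} {q : ℕ} (q-primePower : IsPrimePower q) (K : 𝔸Field q c ℓ) where
  open 𝔸Field K
  open Field L renaming (refl to ≈-refl; sym to ≈-sym; trans to ≈-trans)
  open import Relation.Binary.Reasoning.Setoid setoid
  open import Algebra.Properties.Semiring.Mult semiring using () renaming (_×_ to _×ᵣ_)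
  open import Algebra.Properties.Semiring.Mult (Field.semiring 𝔽q) using () renaming (_×_ to _×q_)
  open import Algebra.Properties.CommutativeSemiring.Exp commutativeSemiring using (_^_)
  open RingMorphisms.IsRingHomomorphism ι₀-hom using (⟦⟧-cong; +-homo; 0#-homo; 1#-homo)
  open ListSums L using (Σ)
  open Powers L

  private
    p = proj₁ q-primePower
    k = proj₁ (proj₂ q-primePower)
    p-prime : Prime p
    p-prime = proj₁ (proj₂ (proj₂ q-primePower))
    q≡p^k : q ≡ p ℕ.^ k
    q≡p^k = proj₂ (proj₂ (proj₂ (proj₂ q-primePower)))

  ι₀-multiple : ∀ n → ι₀ (n ×q Field.1# 𝔽q) ≈ n ×ᵣ 1#
  ι₀-multiple zero    = 0#-homo
  ι₀-multiple (suc n) = ≈-trans (+-homo _ _) (+-cong 1#-homo (ι₀-multiple n))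

  p·1≈0 : p ×ᵣ 1# ≈ 0#
  p·1≈0 = ≈-trans (≈-sym (ι₀-multiple p)) (≈-trans (⟦⟧-cong (FiniteFieldCharacteristic.p·1≈0 𝔽q card p k q≡p^k)) 0#-homo)

  frobenius-q : ∀ m x y → pow L (x + y) (q ℕ.^ m) ≈ pow L x (q ℕ.^ m) + pow L y (q ℕ.^ m)
  frobenius-q m x y = begin
    pow L (x + y) (q ℕ.^ m)                  ≈⟨ pow-congʳ _ q^m≡p^km ⟩
    pow L (x + y) (p ℕ.^ (k ℕ.* m))          ≡⟨ pow≡^ (x + y) (p ℕ.^ (k ℕ.* m)) ⟩
    (x + y) ^ (p ℕ.^ (k ℕ.* m))              ≈⟨ Frobenius.frobenius-iterated commutativeRing p-prime p·1≈0 (k ℕ.* m) x y ⟩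
    x ^ (p ℕ.^ (k ℕ.* m)) + y ^ (p ℕ.^ (k ℕ.* m)) ≡⟨ cong₂ _+_ (pow≡^ x (p ℕ.^ (k ℕ.* m))) (pow≡^ y (p ℕ.^ (k ℕ.* m))) ⟨
    pow L x (p ℕ.^ (k ℕ.* m)) + pow L y (p ℕ.^ (k ℕ.* m)) ≈⟨ +-cong (pow-congʳ x q^m≡p^km) (pow-congʳ y q^m≡p^km) ⟨
    pow L x (q ℕ.^ m) + pow L y (q ℕ.^ m)    ∎
    where
    q^m≡p^km : q ℕ.^ m ≡ p ℕ.^ (k ℕ.* m)
    q^m≡p^km = ≡.trans (cong (ℕ._^ m) q≡p^k) (ℕP.^-*-assoc p k m)

  q^m>0 : ∀ m → 0 < q ℕ.^ m
  q^m>0 m = ℕP.m^n>0 q m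
    where instance q≢0 : ℕ.NonZero q
                   q≢0 = subst ℕ.NonZero (≡.sym q≡p^k) (ℕP.m^n≢0 p k {{prime⇒nonZero p-prime}})

  pow-q-Σ : ∀ m xs → pow L (Σ xs) (q ℕ.^ m) ≈ Σ (map (λ x → pow L x (q ℕ.^ m)) xs)
  pow-q-Σ m []       = pow-0# _ (q^m>0 m)
  pow-q-Σ m (x ∷ xs) = ≈-trans (frobenius-q m x _) (+-congˡ (pow-q-Σ m xs))

module HPolynomials {c ℓ : Level} {q : ℕ} (q-primePower : IsPrimePower q) (K : 𝔸Field q c ℓ) where
  open 𝔸Field K
  open Field L renaming (refl to ≈-refl; sym to ≈-sym; trans to ≈-trans)
  open import Relation.Binary.Reasoning.Setoid setoid
  open ListSums L
  open Powers L
  open FrobeniusOnL q-primePower K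

  exponent : List ℕ → List ℕ → ℕ
  exponent ks S = sumℕ (zipWith (λ kₛ s → kₛ ℕ.* q ℕ.^ s) ks S)

  I-map : ∀ (f : ℕ → ℕ) S k → I (map f S) k ≡ I S k
  I-map f []      zero    = refl
  I-map f []      (suc k) = refl
  I-map f (s ∷ S) k       = cong List.concat (ListP.map-cong (λ j → cong (map (j ∷_)) (I-map f S (k ∸ j))) (upTo (suc k)))

  exponent-shift : ∀ t ks S → exponent ks (map (t ℕ.+_) S) ≡ exponent ks S ℕ.* q ℕ.^ t
  exponent-shift t []       S       = refl
  exponent-shift t (k ∷ ks) []      = refl
  exponent-shift t (k ∷ ks) (s ∷ S) =
    ≡.trans (cong₂ ℕ._+_ shift-term (exponent-shift t ks S)) (≡.sym (ℕP.*-distribʳ-+ (q ℕ.^ t) (k ℕ.* q ℕ.^ s) (exponent ks S)))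
    where
    shift-term : k ℕ.* q ℕ.^ (t ℕ.+ s) ≡ k ℕ.* q ℕ.^ s ℕ.* q ℕ.^ t
    shift-term = ≡.trans (cong (k ℕ.*_) (≡.trans (ℕP.^-distribˡ-+-* q t s) (ℕP.*-comm (q ℕ.^ t) (q ℕ.^ s))))
                         (≡.sym (ℕP.*-assoc k (q ℕ.^ s) (q ℕ.^ t)))

  -- (h^S_k)^{q^t} = h^{t+S}_k, by additivity of the q^t-th power
  h-pow-q : ∀ t S k → pow L (h K S k) (q ℕ.^ t) ≈ h K (map (t ℕ.+_) S) k
  h-pow-q t S k = begin
    pow L (Σ (map monomial (I S k))) (q ℕ.^ t)                          ≈⟨ pow-q-Σ t (map monomial (I S k)) ⟩
    Σ (map (λ x → pow L x (q ℕ.^ t)) (map monomial (I S k)))            ≡⟨ Σ-map-∘ _ monomial (I S k) ⟩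
    Σ (map (λ ks → pow L (monomial ks) (q ℕ.^ t)) (I S k))              ≈⟨ Σ-cong (I S k) (λ ks → ≈-trans (pow-pow T (exponent ks S) (q ℕ.^ t))
                                                                            (pow-congʳ T (≡.sym (exponent-shift t ks S)))) ⟩
    Σ (map (λ ks → pow L T (exponent ks (map (t ℕ.+_) S))) (I S k))     ≡⟨ cong (λ I′ → Σ (map (λ ks → pow L T (exponent ks (map (t ℕ.+_) S))) I′))
                                                                            (≡.sym (I-map (t ℕ.+_) S k)) ⟩
    h K (map (t ℕ.+_) S) k                                               ∎
    where
    monomial : List ℕ → Carrier
    monomial ks = pow L T (exponent ks S)

  h-cons : ∀ s S k → h K (s ∷ S) k ≈ Σ (map (λ j → pow L (pow L T (q ℕ.^ s)) j * h K S (k ∸ j)) (upTo (suc k)))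
  h-cons s S k = begin
    Σ (map monomial (concatMap (λ j → map (j ∷_) (I S (k ∸ j))) (upTo (suc k))))  ≈⟨ Σ-concatMap monomial (λ j → map (j ∷_) (I S (k ∸ j))) (upTo (suc k)) ⟩
    Σ (map (λ j → Σ (map monomial (map (j ∷_) (I S (k ∸ j))))) (upTo (suc k)))    ≈⟨ Σ-cong (upTo (suc k)) first-exponent ⟩
    Σ (map (λ j → pow L (pow L T (q ℕ.^ s)) j * h K S (k ∸ j)) (upTo (suc k)))     ∎
    where
    monomial : List ℕ → Carrier
    monomial ks = pow L T (exponent ks (s ∷ S))
    first-exponent : ∀ j → Σ (map monomial (map (j ∷_) (I S (k ∸ j)))) ≈ pow L (pow L T (q ℕ.^ s)) j * h K S (k ∸ j)
    first-exponent j = begin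
      Σ (map monomial (map (j ∷_) (I S (k ∸ j))))                                      ≡⟨ Σ-map-∘ monomial (j ∷_) (I S (k ∸ j)) ⟩
      Σ (map (λ ks → pow L T (j ℕ.* q ℕ.^ s ℕ.+ exponent ks S)) (I S (k ∸ j)))          ≈⟨ Σ-cong (I S (k ∸ j)) (λ ks → pow-+ T (j ℕ.* q ℕ.^ s) (exponent ks S)) ⟩
      Σ (map (λ ks → pow L T (j ℕ.* q ℕ.^ s) * pow L T (exponent ks S)) (I S (k ∸ j)))  ≈⟨ Σ-*ˡ _ _ (I S (k ∸ j)) ⟩
      pow L T (j ℕ.* q ℕ.^ s) * h K S (k ∸ j)                                          ≈⟨ *-congʳ (≈-trans (pow-congʳ T (ℕP.*-comm j (q ℕ.^ s))) (≈-sym (pow-pow T (q ℕ.^ s) j))) ⟩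
      pow L (pow L T (q ℕ.^ s)) j * h K S (k ∸ j)                                      ∎

  h-cons-0 : ∀ s S → h K (s ∷ S) 0 ≈ h K S 0
  h-cons-0 s S = ≈-trans (h-cons s S 0) (≈-trans (+-identityʳ _) (*-identityˡ _))

  -- h^{s∷S}_{k+1} = T^{q^s} h^{s∷S}_k + h^S_{k+1}: split off j = 0
  h-step : ∀ s S k → h K (s ∷ S) (suc k) ≈ pow L T (q ℕ.^ s) * h K (s ∷ S) k + h K S (suc k)
  h-step s S k = begin
    h K (s ∷ S) (suc k)                                                       ≈⟨ h-cons s S (suc k) ⟩
    Σ (map term (0 ∷ applyUpTo suc (suc k)))                                  ≡⟨ cong (λ js → Σ (map term (0 ∷ js))) (≡.sym (ListP.map-upTo suc (suc k))) ⟩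
    term 0 + Σ (map term (map suc (upTo (suc k))))                            ≡⟨ cong (term 0 +_) (Σ-map-∘ term suc (upTo (suc k))) ⟩
    term 0 + Σ (map (λ j → term (suc j)) (upTo (suc k)))                      ≈⟨ +-cong (*-identityˡ _) (Σ-cong (upTo (suc k)) (λ j → *-assoc _ _ _)) ⟩
    h K S (suc k) + Σ (map (λ j → a * (pow L a j * h K S (k ∸ j))) (upTo (suc k))) ≈⟨ +-congˡ (Σ-*ˡ a _ (upTo (suc k))) ⟩
    h K S (suc k) + a * Σ (map (λ j → pow L a j * h K S (k ∸ j)) (upTo (suc k)))   ≈⟨ +-congˡ (*-congˡ (≈-sym (h-cons s S k))) ⟩
    h K S (suc k) + a * h K (s ∷ S) k                                         ≈⟨ +-comm _ _ ⟩
    a * h K (s ∷ S) k + h K S (suc k)                                         ∎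
    where
    a = pow L T (q ℕ.^ s)
    term : ℕ → Carrier
    term j = pow L a j * h K S (suc k ∸ j)

  h[-]-suc : ∀ S m s → h[_-_] K S (suc m) (suc s) ≡ h[_-_] K S m s
  h[-]-suc S m zero    = refl
  h[-]-suc S m (suc s) = refl

  h[-]-step : ∀ s₀ S m s → h[_-_] K (s₀ ∷ S) (suc m) s ≈ pow L T (q ℕ.^ s₀) * h[_-_] K (s₀ ∷ S) m s + h[_-_] K S (suc m) s
  h[-]-step s₀ S m s with s ℕ.≤? m
  ... | yes s≤m rewrite ≤ᵇ-true s≤m | ≤ᵇ-true (ℕP.m≤n⇒m≤1+n s≤m) | ℕP.+-∸-assoc 1 s≤m = h-step s₀ S (m ∸ s)
  ... | no  s≰m with s ℕ.≟ suc m
  ...   | yes refl rewrite ≤ᵇ-true (ℕP.≤-refl {suc m}) | ≤ᵇ-false (ℕP.n<1+n m) | ℕP.n∸n≡0 m =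
          ≈-trans (h-cons-0 s₀ S) (≈-trans (≈-sym (+-identityˡ _)) (+-congʳ (≈-sym (zeroʳ _))))
  ...   | no  s≢m+1 rewrite ≤ᵇ-false (ℕP.≰⇒> s≰m) | ≤ᵇ-false (ℕP.≤∧≢⇒< (ℕP.≰⇒> s≰m) (λ e → s≢m+1 (≡.sym e))) =
          ≈-trans (≈-sym (+-identityʳ 0#)) (+-congʳ (≈-sym (zeroʳ _)))

  h[-]-pow-q : ∀ t S m s → pow L (h[_-_] K S m s) (q ℕ.^ t) ≈ h[_-_] K (map (t ℕ.+_) S) m s
  h[-]-pow-q t S m s with s ≤ᵇ m
  ... | true  = h-pow-q t S (m ∸ s)
  ... | false = pow-0# _ (q^m>0 t)

module TruncatedSums {c ℓ : Level} (F : Field c ℓ) where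
  open Field F renaming (refl to ≈-refl; sym to ≈-sym; trans to ≈-trans)
  open import Relation.Binary.Reasoning.Setoid setoid
  open ListSums F

  truncated : ∀ (f : ℕ → Carrier) n r → Σ (map (λ j → if suc j ≤ᵇ r then f j else 0#) (upTo n)) ≈ Σ (map f (upTo (n ⊓ r)))
  truncated f zero    r = ≈-refl
  truncated f (suc n) r = begin
      Σ (map f′ (upTo (suc n)))                ≡⟨ cong (λ js → Σ (map f′ js)) (≡.sym (ListP.upTo-∷ʳ n)) ⟩
      Σ (map f′ (upTo n ++ [ n ]))             ≈⟨ Σ-++ f′ (upTo n) [ n ] ⟩
      Σ (map f′ (upTo n)) + (f′ n + 0#)        ≈⟨ +-cong (truncated f n r) (+-identityʳ _) ⟩
      Σ (map f (upTo (n ⊓ r))) + f′ n          ≈⟨ last-term ⟩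
      Σ (map f (upTo (suc n ⊓ r)))             ∎
    where
    f′ = λ j → if suc j ≤ᵇ r then f j else 0#
    last-term : Σ (map f (upTo (n ⊓ r))) + f′ n ≈ Σ (map f (upTo (suc n ⊓ r)))
    last-term with suc n ℕ.≤? r
    ... | yes n<r rewrite ≤ᵇ-true n<r | ℕP.m≤n⇒m⊓n≡m n<r | ℕP.m≤n⇒m⊓n≡m (ℕP.≤-trans (ℕP.n≤1+n n) n<r) = begin
        Σ (map f (upTo n)) + f n               ≈⟨ +-congˡ (+-identityʳ _) ⟨
        Σ (map f (upTo n)) + (f n + 0#)        ≈⟨ Σ-++ f (upTo n) [ n ] ⟨
        Σ (map f (upTo n ++ [ n ]))            ≡⟨ cong (λ js → Σ (map f js)) (ListP.upTo-∷ʳ n) ⟩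
        Σ (map f (upTo (suc n)))               ∎
    ... | no  n≮r rewrite ≤ᵇ-false (ℕP.≰⇒> n≮r) | ℕP.m≥n⇒m⊓n≡n (ℕP.≤-pred (ℕP.≰⇒> n≮r)) | ℕP.m≥n⇒m⊓n≡n (ℕP.<⇒≤ (ℕP.≰⇒> n≮r)) =
        +-identityʳ _

  map-toℕ-allFin : ∀ r → map toℕ (allFin r) ≡ upTo r
  map-toℕ-allFin r = ≡.trans (ListP.map-tabulate (λ i → i) toℕ) (shifted r (λ x → x))
    where
    shifted : ∀ r (f : ℕ → ℕ) → List.tabulate {n = r} (λ i → f (toℕ i)) ≡ applyUpTo f r
    shifted zero    f = refl
    shifted (suc r) f = cong (f 0 ∷_) (shifted r (λ x → f (suc x)))

  reindex : ∀ (f : ℕ → Carrier) n r →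
    Σ (map (λ j → if suc j ≤ᵇ r then f j else 0#) (upTo n)) ≈
    Σ (map (λ i → if suc (toℕ i) ≤ᵇ n then f (toℕ i) else 0#) (allFin r))
  reindex f n r = begin
    Σ (map (λ j → if suc j ≤ᵇ r then f j else 0#) (upTo n))                  ≈⟨ truncated f n r ⟩
    Σ (map f (upTo (n ⊓ r)))                                                 ≡⟨ cong (λ k → Σ (map f (upTo k))) (ℕP.⊓-comm n r) ⟩
    Σ (map f (upTo (r ⊓ n)))                                                 ≈⟨ truncated f r n ⟨
    Σ (map (λ j → if suc j ≤ᵇ n then f j else 0#) (upTo r))                  ≡⟨ cong (λ js → Σ (map (λ j → if suc j ≤ᵇ n then f j else 0#) js)) (≡.sym (map-toℕ-allFin r)) ⟩
    Σ (map (λ j → if suc j ≤ᵇ n then f j else 0#) (map toℕ (allFin r)))     ≡⟨ Σ-map-∘ _ toℕ (allFin r) ⟩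
    Σ (map (λ i → if suc (toℕ i) ≤ᵇ n then f (toℕ i) else 0#) (allFin r))   ∎

module Recursions {c ℓ : Level} {q : ℕ} (q-primePower : IsPrimePower q) (K : 𝔸Field q c ℓ)
                  {r : ℕ} (φ : DrinfeldModule K r) where
  open 𝔸Field K
  open Field L renaming (refl to ≈-refl; sym to ≈-sym; trans to ≈-trans)
  open import Relation.Binary.Reasoning.Setoid setoid
  open DrinfeldModule φ
  open ListSums L
  open Powers L
  open FrobeniusOnL q-primePower K using (pow-q-Σ)
  open HPolynomials q-primePower K
  open TruncatedSums L using (reindex)
  open ShadowedPartitions {r}
  open Decomposition {r}
  open InsertionStatistics {r}
  open EmptyPartition {r}

  twist : (ℕ → Carrier) → ℕ → Carrier
  twist c n = Σ (map (λ i → if suc (toℕ i) ≤ᵇ n then A (suc (toℕ i)) * pow L (c (n ∸ suc (toℕ i))) (q ℕ.^ suc (toℕ i)) else 0#)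
                     (allFin r))

  twist-cong : ∀ {c d} n → (∀ k → c k ≈ d k) → twist c n ≈ twist d n
  twist-cong {c} {d} n c≈d = Σ-cong (allFin r) term
    where
    term : ∀ i → (if suc (toℕ i) ≤ᵇ n then A (suc (toℕ i)) * pow L (c (n ∸ suc (toℕ i))) (q ℕ.^ suc (toℕ i)) else 0#)
               ≈ (if suc (toℕ i) ≤ᵇ n then A (suc (toℕ i)) * pow L (d (n ∸ suc (toℕ i))) (q ℕ.^ suc (toℕ i)) else 0#)
    term i with suc (toℕ i) ≤ᵇ n
    ... | true  = *-congˡ (pow-congˡ (q ℕ.^ suc (toℕ i)) (c≈d (n ∸ suc (toℕ i))))
    ... | false = ≈-refl

  twist-0 : ∀ c → twist c 0 ≈ 0#
  twist-0 c = Σ-zero _ (allFin r) (λ _ → ≈-refl)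

  -- the recursion for c(n;m): the τ^i-coefficient of φ_T contributes A_i c(n-i;m)^{q^i}
  coeff-step : ∀ n m → coeff φ n (suc m) ≈ T * coeff φ n m + twist (λ k → coeff φ k m) n
  coeff-step n m = begin
    coeff φ n (suc m)                                                          ≡⟨ cong (λ js → term 0 + Σ (map term js)) (≡.sym (ListP.map-upTo suc n)) ⟩
    term 0 + Σ (map term (map suc (upTo n)))                                   ≈⟨ +-cong (*-congˡ (pow-1 _)) (reflexive (Σ-map-∘ term suc (upTo n))) ⟩
    T * coeff φ n m + Σ (map (λ j → term (suc j)) (upTo n))                    ≈⟨ +-congˡ (Σ-cong (upTo n) truncate) ⟩
    T * coeff φ n m + Σ (map (λ j → if suc j ≤ᵇ r then f j else 0#) (upTo n))  ≈⟨ +-congˡ (reindex f n r) ⟩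
    T * coeff φ n m + twist (λ k → coeff φ k m) n                              ∎
    where
    term : ℕ → Carrier
    term i = φT φ i * pow L (coeff φ (n ∸ i) m) (q ℕ.^ i)
    f : ℕ → Carrier
    f j = A (suc j) * pow L (coeff φ (n ∸ suc j) m) (q ℕ.^ suc j)
    truncate : ∀ j → term (suc j) ≈ (if suc j ≤ᵇ r then f j else 0#)
    truncate j with suc j ≤ᵇ r
    ... | true  = ≈-refl
    ... | false = zeroˡ _

  summand : ∀ {n} → ℕ → Vec (Subset n) r → Carrier
  summand m 𝐒 = A^ φ 𝐒 * h[_-_] K (unionWithN 𝐒) m (size 𝐒)

  A^-insertAt : ∀ {n n′} i → n ≡ suc (toℕ i) ℕ.+ n′ → (𝐒′ : Vec (Subset n′) r) →
                A^ φ (insertAt {n} i 𝐒′) ≈ A (suc (toℕ i)) * pow L (A^ φ 𝐒′) (q ℕ.^ suc (toℕ i))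
  A^-insertAt {n} i n≡ 𝐒′ = begin
    Π (map (λ j → pow L (Aⱼ j) (w q (lookup (insertAt {n} i 𝐒′) j))) (allFin r))       ≈⟨ Π-cong (allFin r) factor ⟩
    Π (map (λ j → pow L (Aⱼ j) (δ i j) * pow L (pow L (Aⱼ j) (wⱼ j)) e) (allFin r))     ≈⟨ Π-* _ _ (allFin r) ⟩
    Π (map (λ j → pow L (Aⱼ j) (δ i j)) (allFin r)) * Π (map (λ j → pow L (pow L (Aⱼ j) (wⱼ j)) e) (allFin r)) ≈⟨ *-cong new-factor (≈-sym old-factors) ⟩
    A (suc (toℕ i)) * pow L (A^ φ 𝐒′) e                                               ∎
    where
    e = q ℕ.^ suc (toℕ i)
    Aⱼ : Fin r → Carrier
    Aⱼ j = A (suc (toℕ j))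
    wⱼ : Fin r → ℕ
    wⱼ j = w q (lookup 𝐒′ j)
    factor : ∀ j → pow L (Aⱼ j) (w q (lookup (insertAt {n} i 𝐒′) j)) ≈ pow L (Aⱼ j) (δ i j) * pow L (pow L (Aⱼ j) (wⱼ j)) e
    factor j = ≈-trans (pow-congʳ (Aⱼ j) (w-insertAt′ i n≡ 𝐒′ q j)) (≈-trans (pow-+ (Aⱼ j) (δ i j) (e ℕ.* wⱼ j))
                 (*-congˡ (≈-trans (pow-congʳ (Aⱼ j) (ℕP.*-comm e (wⱼ j))) (≈-sym (pow-pow (Aⱼ j) (wⱼ j) e)))))
    new-factor : Π (map (λ j → pow L (Aⱼ j) (δ i j)) (allFin r)) ≈ A (suc (toℕ i))
    new-factor = ≈-trans (Π-single _ (Unique.allFin⁺ r) (∈-allFin i) λ j j≢i → pow-congʳ (Aⱼ j) (cong χ (dec-false (j Fin.≟ i) j≢i)))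
                         (≈-trans (pow-congʳ (Aⱼ i) (cong χ (dec-true (i Fin.≟ i) refl))) (pow-1 _))
    old-factors : pow L (A^ φ 𝐒′) e ≈ Π (map (λ j → pow L (pow L (Aⱼ j) (wⱼ j)) e) (allFin r))
    old-factors = ≈-trans (pow-Π e (map (λ j → pow L (Aⱼ j) (wⱼ j)) (allFin r))) (reflexive (cong Π (≡.sym (ListP.map-∘ (allFin r)))))

  summand-insertAt : ∀ {n n′} i → n ≡ suc (toℕ i) ℕ.+ n′ → (𝐒′ : Vec (Subset n′) r) → ∀ m →
    summand (suc m) (insertAt {n} i 𝐒′) ≈ T * summand m (insertAt {n} i 𝐒′) + A (suc (toℕ i)) * pow L (summand m 𝐒′) (q ℕ.^ suc (toℕ i))
  summand-insertAt {n} i n≡ 𝐒′ m rewrite union-insertAt′ i n≡ 𝐒′ | size-insertAt′ i n≡ 𝐒′ = begin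
      𝐀 * h[_-_] K (0 ∷ V) (suc m) (suc s)                          ≈⟨ *-congˡ (h[-]-step 0 V m (suc s)) ⟩
      𝐀 * (pow L T 1 * X + h[_-_] K V (suc m) (suc s))              ≈⟨ *-congˡ (+-cong (*-congʳ (pow-1 T)) (reflexive (h[-]-suc V m s))) ⟩
      𝐀 * (T * X + h[_-_] K V m s)                                  ≈⟨ distribˡ _ _ _ ⟩
      𝐀 * (T * X) + 𝐀 * h[_-_] K V m s                              ≈⟨ +-cong (x∙yz≈y∙xz 𝐀 T X) (*-cong (A^-insertAt i n≡ 𝐒′) (≈-sym (h[-]-pow-q e U′ m s))) ⟩
      T * (𝐀 * X) + (Aᵢ * pow L (A^ φ 𝐒′) qᵉ) * pow L (h[_-_] K U′ m s) qᵉ ≈⟨ +-congˡ (*-assoc _ _ _) ⟩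
      T * (𝐀 * X) + Aᵢ * (pow L (A^ φ 𝐒′) qᵉ * pow L (h[_-_] K U′ m s) qᵉ) ≈⟨ +-congˡ (*-congˡ (≈-sym (pow-* _ _ qᵉ))) ⟩
      T * (𝐀 * X) + Aᵢ * pow L (summand m 𝐒′) qᵉ                     ∎
    where
    open import Algebra.Properties.CommutativeSemigroup *-commutativeSemigroup using (x∙yz≈y∙xz)
    e = suc (toℕ i)
    qᵉ = q ℕ.^ e
    Aᵢ = A e
    𝐀 = A^ φ (insertAt {n} i 𝐒′)
    U′ = unionWithN 𝐒′
    V = map (e ℕ.+_) U′
    s = size 𝐒′
    X = h[_-_] K (0 ∷ V) m (suc s)

  summand-insertAt-0 : ∀ {n n′} i → n ≡ suc (toℕ i) ℕ.+ n′ → (𝐒′ : Vec (Subset n′) r) → summand 0 (insertAt {n} i 𝐒′) ≈ 0#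
  summand-insertAt-0 i n≡ 𝐒′ rewrite size-insertAt′ i n≡ 𝐒′ = zeroʳ _

  sum-by-blocks : ∀ n₀ (G : Vec (Subset (suc n₀)) r → Carrier) →
    Σ (map G (P r (suc n₀))) ≈
    Σ (map (λ i → if suc (toℕ i) ≤ᵇ suc n₀ then Σ (map (λ 𝐒′ → G (insertAt i 𝐒′)) (P r (suc n₀ ∸ suc (toℕ i)))) else 0#) (allFin r))
  sum-by-blocks n₀ G = begin
    Σ (map G (P r n))                                  ≈⟨ Σ-sameMembers G (P-unique r n) (blocks-unique n) (P⊆blocks n₀) (blocks⊆P n) ⟩
    Σ (map G (blocks n))                               ≈⟨ Σ-concatMap G (block n) (allFin r) ⟩
    Σ (map (λ i → Σ (map G (block n i))) (allFin r))   ≈⟨ Σ-cong (allFin r) inserted ⟩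
    Σ (map (λ i → if suc (toℕ i) ≤ᵇ n then Σ (map (λ 𝐒′ → G (insertAt i 𝐒′)) (P r (n ∸ suc (toℕ i)))) else 0#) (allFin r)) ∎
    where
    n = suc n₀
    inserted : ∀ i → Σ (map G (block n i)) ≈ (if suc (toℕ i) ≤ᵇ n then Σ (map (λ 𝐒′ → G (insertAt i 𝐒′)) (P r (n ∸ suc (toℕ i)))) else 0#)
    inserted i with suc (toℕ i) ≤ᵇ n
    ... | true  = reflexive (Σ-map-∘ G (insertAt i) (P r (n ∸ suc (toℕ i))))
    ... | false = ≈-refl

  blockSum : ℕ → ℕ → Fin r → Carrier
  blockSum m n i = if suc (toℕ i) ≤ᵇ n then Σ (map (λ 𝐒′ → summand m (insertAt {n} i 𝐒′)) (P r (n ∸ suc (toℕ i)))) else 0#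

  blockSum-step : ∀ n m i → blockSum (suc m) n i ≈ T * blockSum m n i +
    (if suc (toℕ i) ≤ᵇ n then A (suc (toℕ i)) * pow L (rhs φ (n ∸ suc (toℕ i)) m) (q ℕ.^ suc (toℕ i)) else 0#)
  blockSum-step n m i with suc (toℕ i) ≤ᵇ n in i<n
  ... | false = ≈-sym (≈-trans (+-congʳ (zeroʳ T)) (+-identityˡ 0#))
  ... | true  = begin
      Σ (map (λ 𝐒′ → summand (suc m) (insertAt i 𝐒′)) Ps)                                              ≈⟨ Σ-cong Ps (λ 𝐒′ → summand-insertAt i n≡ 𝐒′ m) ⟩
      Σ (map (λ 𝐒′ → T * summand m (insertAt i 𝐒′) + Aᵢ * pow L (summand m 𝐒′) qᵉ) Ps)                   ≈⟨ Σ-+ _ _ Ps ⟩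
      Σ (map (λ 𝐒′ → T * summand m (insertAt i 𝐒′)) Ps) + Σ (map (λ 𝐒′ → Aᵢ * pow L (summand m 𝐒′) qᵉ) Ps) ≈⟨ +-cong (Σ-*ˡ T _ Ps) (Σ-*ˡ Aᵢ _ Ps) ⟩
      T * Σ (map (λ 𝐒′ → summand m (insertAt i 𝐒′)) Ps) + Aᵢ * Σ (map (λ 𝐒′ → pow L (summand m 𝐒′) qᵉ) Ps) ≈⟨ +-congˡ (*-congˡ (≈-sym frobenius)) ⟩
      T * Σ (map (λ 𝐒′ → summand m (insertAt i 𝐒′)) Ps) + Aᵢ * pow L (rhs φ (n ∸ e) m) qᵉ                ∎
    where
    e = suc (toℕ i)
    qᵉ = q ℕ.^ e
    Aᵢ = A e
    Ps = P r (n ∸ e)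
    n≡ : n ≡ e ℕ.+ (n ∸ e)
    n≡ = ≡.sym (ℕP.m+[n∸m]≡n (≤ᵇ-sound i<n))
    frobenius : pow L (rhs φ (n ∸ e) m) qᵉ ≈ Σ (map (λ 𝐒′ → pow L (summand m 𝐒′) qᵉ) Ps)
    frobenius = ≈-trans (pow-q-Σ e (map (summand m) Ps)) (reflexive (Σ-map-∘ (λ x → pow L x qᵉ) (summand m) Ps))

  blockSum-0 : ∀ n i → blockSum 0 n i ≈ 0#
  blockSum-0 n i with suc (toℕ i) ≤ᵇ n in i<n
  ... | false = ≈-refl
  ... | true  = Σ-zero _ (P r (n ∸ suc (toℕ i))) λ 𝐒′ → summand-insertAt-0 i (≡.sym (ℕP.m+[n∸m]≡n (≤ᵇ-sound i<n))) 𝐒′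

  -- for n = 0 the only tuple is ∅ and the right-hand side is h^{{0}}_m = T^m
  rhs-empty : ∀ m → rhs φ 0 m ≈ h K [ 0 ] m
  rhs-empty m rewrite P₀ | size-∅ = ≈-trans (+-identityʳ _) (≈-trans (*-congʳ A^∅≈1) (*-identityˡ _))
    where
    A^∅≈1 : A^ φ ∅ ≈ 1#
    A^∅≈1 = Π-ones _ (allFin r) λ {j} _ → reflexive (cong (pow L (A (suc (toℕ j)))) (w-∅ q j))

  rhs-step : ∀ n m → rhs φ n (suc m) ≈ T * rhs φ n m + twist (λ k → rhs φ k m) n
  rhs-step zero m = begin
    rhs φ 0 (suc m)                                      ≈⟨ rhs-empty (suc m) ⟩
    h K [ 0 ] (suc m)                                    ≈⟨ h-step 0 [] m ⟩
    pow L T 1 * h K [ 0 ] m + 0#                         ≈⟨ +-cong (*-cong (pow-1 T) (≈-sym (rhs-empty m))) (≈-sym (twist-0 (λ k → rhs φ k m))) ⟩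
    T * rhs φ 0 m + twist (λ k → rhs φ k m) 0            ∎
  rhs-step (suc n₀) m = begin
    rhs φ n (suc m)                                                           ≈⟨ sum-by-blocks n₀ (summand (suc m)) ⟩
    Σ (map (blockSum (suc m) n) (allFin r))                                   ≈⟨ Σ-cong (allFin r) (blockSum-step n m) ⟩
    Σ (map (λ i → T * blockSum m n i + new i) (allFin r))                     ≈⟨ Σ-+ _ new (allFin r) ⟩
    Σ (map (λ i → T * blockSum m n i) (allFin r)) + twist (λ k → rhs φ k m) n ≈⟨ +-congʳ (Σ-*ˡ T _ (allFin r)) ⟩
    T * Σ (map (blockSum m n) (allFin r)) + twist (λ k → rhs φ k m) n         ≈⟨ +-congʳ (*-congˡ (sum-by-blocks n₀ (summand m))) ⟨
    T * rhs φ n m + twist (λ k → rhs φ k m) n                                 ∎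
    where
    n = suc n₀
    new : Fin r → Carrier
    new i = if suc (toℕ i) ≤ᵇ n then A (suc (toℕ i)) * pow L (rhs φ (n ∸ suc (toℕ i)) m) (q ℕ.^ suc (toℕ i)) else 0#

  base : ∀ n → coeff φ n 0 ≈ rhs φ n 0
  base zero     = ≈-sym (≈-trans (rhs-empty 0) (≈-trans (h-cons-0 0 []) (+-identityʳ _)))
  base (suc n₀) = ≈-sym (≈-trans (sum-by-blocks n₀ (summand 0)) (Σ-zero _ (allFin r) (blockSum-0 (suc n₀))))

theorem8p1 : ∀ {c ℓ : Level} {q : ℕ} → IsPrimePower q →
    (K : 𝔸Field q c ℓ) (r : ℕ) → 1 ≤ r → (φ : DrinfeldModule K r) →
    ∀ (m n : ℕ) → Field._≈_ (𝔸Field.L K) (coeff φ n m) (rhs φ n m)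
theorem8p1 q-primePower K r _ φ = coeff≈rhs
  where
  open 𝔸Field K using (L; T)
  open Field L
  open import Relation.Binary.Reasoning.Setoid setoid
  open Recursions q-primePower K φ
  coeff≈rhs : ∀ m n → coeff φ n m ≈ rhs φ n m
  coeff≈rhs zero    n = base n
  coeff≈rhs (suc m) n = begin
    coeff φ n (suc m)                               ≈⟨ coeff-step n m ⟩
    T * coeff φ n m + twist (λ k → coeff φ k m) n   ≈⟨ +-cong (*-congˡ (coeff≈rhs m n)) (twist-cong n (λ k → coeff≈rhs m k)) ⟩
    T * rhs φ n m + twist (λ k → rhs φ k m) n       ≈⟨ rhs-step n m ⟨
    rhs φ n (suc m)                                 ∎
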